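{- On $\mathsf{PTSC}\alpha$ terms and lists, the reduction relations $\to_{\mathsf{x}'}$ and $\to_{\mathsf{Bx}'}$ are both confluent.
   Context: Fix a set $\mathcal S$ of sorts ($s,\dots$), a denumerable set of variables, and two denumerable sets of meta-variables: term meta-variables $\alpha$ and list meta-variables $\beta$, each with a fixed arity $n$. $\mathsf{PTSC}\alpha$ terms and lists: $M ::= \Pi x^{A}.B \mid \lambda x^{A}.M \mid s \mid x\,l \mid M\,l \mid \langle N/x\rangle_A M \mid \alpha(M_1,\dots,M_n)$, $l ::= [\,] \mid M\cdot l \mid l @ l' \mid \langle N/x\rangle_A l \mid \beta(M_1,\dots,M_n)$, where $x\,l$, $M\,l$ are applications of a head to an argument list, $M\cdot l$ is cons, $l@l'$ is explicit concatenation, $\langle N/x\rangle_A(\cdot)$ is explicit substitution with type annotation $A$ (binding $x$); $\Pi x^A.B$ and $\lambda x^A.M$ bind $x$; free variables of $\alpha(M_1,\dots,M_n)$, $\beta(M_1,\dots,M_n)$ are those of the $M_i$; everything up to $\alpha$-conversion. Rules (capture-avoiding side conditions understood): (B) $(\lambda x^A.M)\,(N\cdot l)\to(\langle N/x\rangle_A M)\,l$; and system $\mathsf{x}'$: (B1) $M\,[\,]\to M$; (B2) $(x\,l)\,l'\to x\,(l@l')$; (B3) $(M\,l)\,l'\to M\,(l@l')$; (A1) $(M\cdot l')@l\to M\cdot(l'@l)$; (A2) $[\,]@l\to l$; (A3) $(l@l')@l''\to l@(l'@l'')$; (A4) $l@[\,]\to l$; (C1) $\langle P/y\rangle_G(\lambda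 x^A.M)\to\lambda x^{\langle P/y\rangle_G A}.\langle P/y\rangle_G M$; (C2) $\langle P/y\rangle_G(y\,l)\to P\,(\langle P/y\rangle_G l)$; (C3) $\langle P/y\rangle_G(x\,l)\to x\,(\langle P/y\rangle_G l)$ if $x\neq y$; (C4) $\langle P/y\rangle_G(M\,l)\to(\langle P/y\rangle_G M)\,(\langle P/y\rangle_G l)$; (C5) $\langle P/y\rangle_G(\Pi x^A.B)\to\Pi x^{\langle P/y\rangle_G A}.\langle P/y\rangle_G B$; (C6) $\langle P/y\rangle_G s\to s$; (C$\alpha$) $\langle P/y\rangle_G\alpha(M_1,\dots,M_n)\to\alpha(\langle P/y\rangle_G M_1,\dots,\langle P/y\rangle_G M_n)$; (D1) $\langle P/y\rangle_G[\,]\to[\,]$; (D2) $\langle P/y\rangle_G(M\cdot l)\to(\langle P/y\rangle_G M)\cdot(\langle P/y\rangle_G l)$; (D3) $\langle P/y\rangle_G(l@l')\to(\langle P/y\rangle_G l)@(\langle P/y\rangle_G l')$; (D$\beta$) $\langle P/y\rangle_G\beta(M_1,\dots,M_n)\to\beta(\langle P/y\rangle_G M_1,\dots,\langle P/y\rangle_G M_n)$. $\to_{\mathsf{x}'}$ is the contextual closure of the $\mathsf{x}'$ rules and $\to_{\mathsf{Bx}'}$ the contextual closure of all rules (rules may fire inside terms and lists). -}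

module Defs where

open import Data.Nat using (ℕ; zero; suc)
open import Data.Vec using (Vec; []; _∷_; map)
open import Data.Product using (∃; _×_)
open import Relation.Binary.Construct.Closure.ReflexiveTransitive using (Star)

Confluent : {A : Set} → (A → A → Set) → Set
Confluent {A} R = ∀ {a b c : A} → Star R a b → Star R a c →
  ∃ λ d → Star R b d × Star R c d

-- PTSCα syntax with de Bruijn indices (terms up to α-conversion).  Term meta-variables are named by ℕ, α having arity arT α;
-- list meta-variables are named by ℕ, β having arity arL β.
module PTSC (S : Set) (arT : ℕ → ℕ) (arL : ℕ → ℕ) where

  mutual
    data Term : Set where
      pi    : Term → Term → Term          -- Π x^A. B      (B under binder)
      lam   : Term → Term → Term          -- λ x^A. M      (M under binder)
      sort  : S → Term
      vapp  : ℕ → Lst → Term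
      app   : Term → Lst → Term
      esub  : Term → Term → Term → Term   -- ⟨N/x⟩_A M = esub N A M  (M under binder)
      meta  : (α : ℕ) → Vec Term (arT α) → Term

    data Lst : Set where
      nil   : Lst
      cons  : Term → Lst → Lst
      cat   : Lst → Lst → Lst
      esubL : Term → Term → Lst → Lst     -- ⟨N/x⟩_A l = esubL N A l  (l under binder)
      metaL : (β : ℕ) → Vec Term (arL β) → Lst

  ext : (ℕ → ℕ) → ℕ → ℕ
  ext ρ zero    = zero
  ext ρ (suc n) = suc (ρ n)

  mutual
    renT : (ℕ → ℕ) → Term → Term
    renT ρ (pi A B)     = pi (renT ρ A) (renT (ext ρ) B)
    renT ρ (lam A M)    = lam (renT ρ A) (renT (ext ρ) M)
    renT ρ (sort s)     = sort s
    renT ρ (vapp x l)   = vapp (ρ x) (renL ρ l)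
    renT ρ (app M l)    = app (renT ρ M) (renL ρ l)
    renT ρ (esub N A M) = esub (renT ρ N) (renT ρ A) (renT (ext ρ) M)
    renT ρ (meta α Ms)  = meta α (renV ρ Ms)

    renL : (ℕ → ℕ) → Lst → Lst
    renL ρ nil           = nil
    renL ρ (cons M l)    = cons (renT ρ M) (renL ρ l)
    renL ρ (cat l l')    = cat (renL ρ l) (renL ρ l')
    renL ρ (esubL N A l) = esubL (renT ρ N) (renT ρ A) (renL (ext ρ) l)
    renL ρ (metaL β Ms)  = metaL β (renV ρ Ms)

    renV : ∀ {n} → (ℕ → ℕ) → Vec Term n → Vec Term n
    renV ρ []       = []
    renV ρ (M ∷ Ms) = renT ρ M ∷ renV ρ Ms

  wk : Term → Term
  wk = renT suc

  swap01 : ℕ → ℕ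
  swap01 zero          = suc zero
  swap01 (suc zero)    = zero
  swap01 (suc (suc n)) = suc (suc n)

  data XT : Term → Term → Set where
    B1 : ∀ {M} → XT (app M nil) M
    B2 : ∀ {x l l'} → XT (app (vapp x l) l') (vapp x (cat l l'))
    B3 : ∀ {M l l'} → XT (app (app M l) l') (app M (cat l l'))
    C1 : ∀ {P G A M} →
         XT (esub P G (lam A M)) (lam (esub P G A) (esub (wk P) (wk G) (renT swap01 M)))
    C2 : ∀ {P G l} → XT (esub P G (vapp zero l)) (app P (esubL P G l))
    C3 : ∀ {P G x l} → XT (esub P G (vapp (suc x) l)) (vapp x (esubL P G l))
    C4 : ∀ {P G M l} → XT (esub P G (app M l)) (app (esub P G M) (esubL P G l))
    C5 : ∀ {P G A B} →
         XT (esub P G (pi A B)) (pi (esub P G A) (esub (wk P) (wk G) (renT swap01 B)))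
    C6 : ∀ {P G s} → XT (esub P G (sort s)) (sort s)
    Cα : ∀ {P G α Ms} → XT (esub P G (meta α Ms)) (meta α (map (esub P G) Ms))

  data XL : Lst → Lst → Set where
    A1 : ∀ {M l' l} → XL (cat (cons M l') l) (cons M (cat l' l))
    A2 : ∀ {l} → XL (cat nil l) l
    A3 : ∀ {l l' l''} → XL (cat (cat l l') l'') (cat l (cat l' l''))
    A4 : ∀ {l} → XL (cat l nil) l
    D1 : ∀ {P G} → XL (esubL P G nil) nil
    D2 : ∀ {P G M l} → XL (esubL P G (cons M l)) (cons (esub P G M) (esubL P G l))
    D3 : ∀ {P G l l'} → XL (esubL P G (cat l l')) (cat (esubL P G l) (esubL P G l'))
    Dβ : ∀ {P G β Ms} → XL (esubL P G (metaL β Ms)) (metaL β (map (esub P G) Ms))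

  data BxT : Term → Term → Set where
    B : ∀ {A M N l} → BxT (app (lam A M) (cons N l)) (app (esub N A M) l)
    x : ∀ {M N} → XT M N → BxT M N

  module Closure (Rt : Term → Term → Set) (Rl : Lst → Lst → Set) where
    mutual
      data _⟶t_ : Term → Term → Set where
        root   : ∀ {M N} → Rt M N → M ⟶t N
        piˡ    : ∀ {A A' B} → A ⟶t A' → pi A B ⟶t pi A' B
        piʳ    : ∀ {A B B'} → B ⟶t B' → pi A B ⟶t pi A B'
        lamˡ   : ∀ {A A' M} → A ⟶t A' → lam A M ⟶t lam A' M
        lamʳ   : ∀ {A M M'} → M ⟶t M' → lam A M ⟶t lam A M'
        vappʳ  : ∀ {x l l'} → l ⟶l l' → vapp x l ⟶t vapp x l'
        appˡ   : ∀ {M M' l} → M ⟶t M' → app M l ⟶t app M' l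
        appʳ   : ∀ {M l l'} → l ⟶l l' → app M l ⟶t app M l'
        esub₁  : ∀ {N N' A M} → N ⟶t N' → esub N A M ⟶t esub N' A M
        esub₂  : ∀ {N A A' M} → A ⟶t A' → esub N A M ⟶t esub N A' M
        esub₃  : ∀ {N A M M'} → M ⟶t M' → esub N A M ⟶t esub N A M'
        metaᶜ  : ∀ {α Ms Ms'} → Ms ⟶v Ms' → meta α Ms ⟶t meta α Ms'

      data _⟶l_ : Lst → Lst → Set where
        root   : ∀ {l l'} → Rl l l' → l ⟶l l'
        consˡ  : ∀ {M M' l} → M ⟶t M' → cons M l ⟶l cons M' l
        consʳ  : ∀ {M l l'} → l ⟶l l' → cons M l ⟶l cons M l'
        catˡ   : ∀ {l₁ l₁' l₂} → l₁ ⟶l l₁' → cat l₁ l₂ ⟶l cat l₁' l₂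
        catʳ   : ∀ {l₁ l₂ l₂'} → l₂ ⟶l l₂' → cat l₁ l₂ ⟶l cat l₁ l₂'
        esubL₁ : ∀ {N N' A l} → N ⟶t N' → esubL N A l ⟶l esubL N' A l
        esubL₂ : ∀ {N A A' l} → A ⟶t A' → esubL N A l ⟶l esubL N A' l
        esubL₃ : ∀ {N A l l'} → l ⟶l l' → esubL N A l ⟶l esubL N A l'
        metaLᶜ : ∀ {β Ms Ms'} → Ms ⟶v Ms' → metaL β Ms ⟶l metaL β Ms'

      data _⟶v_ : ∀ {n} → Vec Term n → Vec Term n → Set where
        here  : ∀ {n M M'} {Ms : Vec Term n} → M ⟶t M' → (M ∷ Ms) ⟶v (M' ∷ Ms)
        there : ∀ {n M} {Ms Ms' : Vec Term n} → Ms ⟶v Ms' → (M ∷ Ms) ⟶v (M ∷ Ms')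

  module X'  = Closure XT XL
  module BX' = Closure BxT XL

  _⟶x'_ : Term → Term → Set
  _⟶x'_ = X'._⟶t_
  _⟶x'ˡ_ : Lst → Lst → Set
  _⟶x'ˡ_ = X'._⟶l_
  _⟶Bx'_ : Term → Term → Set
  _⟶Bx'_ = BX'._⟶t_
  _⟶Bx'ˡ_ : Lst → Lst → Set
  _⟶Bx'ˡ_ = BX'._⟶l_

module Submission where

-- Explicit substitutions, concatenations and nested applications
-- are "administrative" redexes: the system x' eliminates them completely.  We
-- define implicit substitution  sub σ  on the raw syntax so that  nf = sub ids
-- computes the x'-normal form of every term and list, and prove
--   (i)  every object x'-reduces to its normal form, and
--   (ii) an x'-step does not change the result of  sub σ.
-- Together these give confluence of x' (a relation reaching a normaliser that
-- its steps leave invariant is confluent).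
--
-- For Bx' we use the interpretation method.  On x'-normal forms, B is
-- simulated by a parallel reduction ⇛ that performs β-redexes with implicit
-- substitution.  ⇛ has Takahashi's triangle property w.r.t. a complete
-- development  cd,  hence is confluent on normal forms; every Bx'-step is
-- mapped by  nf  to a ⇛-sequence, and every ⇛-step between normal forms is
-- realised by a Bx'-sequence.  The abstract transfer lemma then yields
-- confluence of Bx'.

open import Data.Nat using (ℕ; zero; suc)
open import Data.Product using (_×_; _,_; ∃)
open import Data.Vec using (Vec; []; _∷_; map)
open import Relation.Binary.PropositionalEquality
  using (_≡_; refl; sym; trans; cong; cong₂; subst; subst₂; _≗_)
open import Relation.Binary.Construct.Closure.ReflexiveTransitive
  using (Star; ε; _◅_; _◅◅_; gmap)
open import Defs

infixr 5 _▸_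
_▸_ : {X : Set} {u v w : X} → u ≡ v → v ≡ w → u ≡ w
_▸_ = trans

cast : {X : Set} {R : X → X → Set} {u u' v v' : X} →
       u ≡ u' → v ≡ v' → Star R u v → Star R u' v'
cast = subst₂ (Star _)

-- A relation is confluent as soon as some function f is reached from every
-- object and is invariant under single steps: f a is then a common reduct.
confluent-by-normaliser : {X : Set} (R : X → X → Set) (f : X → X) →
  (∀ a → Star R a (f a)) → (∀ {a b} → R a b → f a ≡ f b) → Confluent R
confluent-by-normaliser R f reach invariant {a} ab ac =
  f a , cast refl (sym (along ab)) (reach _) , cast refl (sym (along ac)) (reach _)
  where
  along : ∀ {u v} → Star R u v → f u ≡ f v
  along ε        = refl
  along (d ◅ ds) = invariant d ▸ along ds

-- Takahashi's triangle property: if every R-step a → b from an object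
-- satisfying Inv can be closed by one further step b → develop a, then R is
-- confluent on Inv (Inv being preserved by R).
module Triangle {X : Set} (R : X → X → Set) (Inv : X → Set)
  (Inv-pres : ∀ {a b} → Inv a → R a b → Inv b)
  (develop : X → X) (triangle : ∀ {a b} → Inv a → R a b → R b (develop a)) where

  strip : ∀ {a b c} → Inv a → R a b → Star R a c → ∃ λ d → Star R b d × R c d
  strip {b = b} ia ab ε = b , ε , ab
  strip ia ab (ac ◅ cs) with strip (Inv-pres ia ac) (triangle ia ac) cs
  ... | d , devd , cd = d , (triangle ia ab ◅ devd) , cd

  confluent-on : ∀ {a b c} → Inv a → Star R a b → Star R a c →
                 ∃ λ d → Star R b d × Star R c d
  confluent-on {c = c} ia ε ac = c , ac , ε
  confluent-on ia (ab ◅ bs) ac with strip ia ab ac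
  ... | d₁ , bd₁ , cd₁ with confluent-on (Inv-pres ia ab) bs bd₁
  ... | d , bd , d₁d = d , bd , (cd₁ ◅ d₁d)

interpretation : {X : Set} (step R : X → X → Set) (Inv : X → Set) (nf : X → X) →
  (∀ a → Star step a (nf a)) → (∀ a → Inv (nf a)) →
  (∀ {a b} → step a b → Star R (nf a) (nf b)) →
  (∀ {a b} → Inv a → R a b → Star step a b) →
  (∀ {a b} → Inv a → R a b → Inv b) →
  (∀ {a b c} → Inv a → Star R a b → Star R a c → ∃ λ d → Star R b d × Star R c d) →
  Confluent step
interpretation step R Inv nf reach Inv-nf simulate realise Inv-pres R-confluent {a} ab ac =
  let (d , bd , cd) = R-confluent (Inv-nf a) (simulateS ab) (simulateS ac)
  in d , (reach _ ◅◅ realiseS (Inv-nf _) bd) , (reach _ ◅◅ realiseS (Inv-nf _) cd)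
  where
  simulateS : ∀ {u v} → Star step u v → Star R (nf u) (nf v)
  simulateS ε        = ε
  simulateS (d ◅ ds) = simulate d ◅◅ simulateS ds

  realiseS : ∀ {u v} → Inv u → Star R u v → Star step u v
  realiseS iu ε        = ε
  realiseS iu (d ◅ ds) = realise iu d ◅◅ realiseS (Inv-pres iu d) ds

module PTSCConfluence (S : Set) (arT arL : ℕ → ℕ) where
  open PTSC S arT arL

  private variable
    A A' Q Q' M M' N N' P : Term
    l l' l₀ l₀' l₁ l₂ : Lst

  -- Normalising concatenation and application.  catN l₁ l₂ and appN M l are
  -- the x'-normal forms of l₁ @ l₂ and M l when l₁, l₂, M are x'-normal: the
  -- rules A1-A4 and B1-B3 are executed eagerly.  The helpers cat? and app?
  -- build c @ l and M l unless l is [ ] (rules A4 and B1).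
  cat? : Lst → Lst → Lst
  cat? c nil           = c
  cat? c (cons M l)    = cat c (cons M l)
  cat? c (cat l₁ l₂)   = cat c (cat l₁ l₂)
  cat? c (esubL N A l) = cat c (esubL N A l)
  cat? c (metaL β Ms)  = cat c (metaL β Ms)

  catN : Lst → Lst → Lst
  catN nil           l' = l'
  catN (cons M l)    l' = cons M (catN l l')
  catN (cat c d)     l' = cat c (catN d l')
  catN (esubL N A l) l' = cat? (esubL N A l) l'
  catN (metaL β Ms)  l' = cat? (metaL β Ms) l'

  app? : Term → Lst → Term
  app? M nil           = M
  app? M (cons N l)    = app M (cons N l)
  app? M (cat l₁ l₂)   = app M (cat l₁ l₂)
  app? M (esubL N A l) = app M (esubL N A l)
  app? M (metaL β Ms)  = app M (metaL β Ms)

  appN : Term → Lst → Term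
  appN (vapp k l₀)  l = vapp k (catN l₀ l)
  appN (app M l₀)   l = app M (catN l₀ l)
  appN (pi A Q)     l = app? (pi A Q) l
  appN (lam A Q)    l = app? (lam A Q) l
  appN (sort s)     l = app? (sort s) l
  appN (esub N A Q) l = app? (esub N A Q) l
  appN (meta α Ms)  l = app? (meta α Ms) l

  data NonNil : Lst → Set where
    nncons  : NonNil (cons M l)
    nncat   : NonNil (cat l₁ l₂)
    nnesubL : NonNil (esubL N A l)
    nnmetaL : ∀ {β} {Ms : Vec Term (arL β)} → NonNil (metaL β Ms)

  cat?-nonNil : ∀ c → NonNil l → cat? c l ≡ cat c l
  cat?-nonNil c nncons  = refl
  cat?-nonNil c nncat   = refl
  cat?-nonNil c nnesubL = refl
  cat?-nonNil c nnmetaL = refl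

  app?-nonNil : ∀ M → NonNil l → app? M l ≡ app M l
  app?-nonNil M nncons  = refl
  app?-nonNil M nncat   = refl
  app?-nonNil M nnesubL = refl
  app?-nonNil M nnmetaL = refl

  NonNil-cat? : ∀ {c} l → NonNil c → NonNil (cat? c l)
  NonNil-cat? nil           h = h
  NonNil-cat? (cons _ _)    h = nncat
  NonNil-cat? (cat _ _)     h = nncat
  NonNil-cat? (esubL _ _ _) h = nncat
  NonNil-cat? (metaL _ _)   h = nncat

  NonNil-catN : ∀ l₂ → NonNil l₁ → NonNil (catN l₁ l₂)
  NonNil-catN l₂ nncons  = nncons
  NonNil-catN l₂ nncat   = nncat
  NonNil-catN l₂ nnesubL = NonNil-cat? l₂ nnesubL
  NonNil-catN l₂ nnmetaL = NonNil-cat? l₂ nnmetaL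

  catN-nilʳ : ∀ l → catN l nil ≡ l
  catN-nilʳ nil           = refl
  catN-nilʳ (cons M l)    = cong (cons M) (catN-nilʳ l)
  catN-nilʳ (cat c d)     = cong (cat c) (catN-nilʳ d)
  catN-nilʳ (esubL N A l) = refl
  catN-nilʳ (metaL β Ms)  = refl

  cat?-assoc : ∀ c l₂ l₃ → (∀ l → catN c l ≡ cat? c l) →
               catN (cat? c l₂) l₃ ≡ cat? c (catN l₂ l₃)
  cat?-assoc c nil           l₃ h = h l₃
  cat?-assoc c (cons M l)    l₃ h = refl
  cat?-assoc c (cat l₁ l₂)   l₃ h = refl
  cat?-assoc c (esubL N A l) l₃ h = sym (cat?-nonNil c (NonNil-cat? l₃ nnesubL))
  cat?-assoc c (metaL β Ms)  l₃ h = sym (cat?-nonNil c (NonNil-cat? l₃ nnmetaL))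

  catN-assoc : ∀ l₁ l₂ l₃ → catN (catN l₁ l₂) l₃ ≡ catN l₁ (catN l₂ l₃)
  catN-assoc nil           l₂ l₃ = refl
  catN-assoc (cons M l)    l₂ l₃ = cong (cons M) (catN-assoc l l₂ l₃)
  catN-assoc (cat c d)     l₂ l₃ = cong (cat c) (catN-assoc d l₂ l₃)
  catN-assoc (esubL N A l) l₂ l₃ = cat?-assoc (esubL N A l) l₂ l₃ (λ _ → refl)
  catN-assoc (metaL β Ms)  l₂ l₃ = cat?-assoc (metaL β Ms) l₂ l₃ (λ _ → refl)

  appN-nilʳ : ∀ M → appN M nil ≡ M
  appN-nilʳ (vapp k l₀)  = cong (vapp k) (catN-nilʳ l₀)
  appN-nilʳ (app M l₀)   = cong (app M) (catN-nilʳ l₀)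
  appN-nilʳ (pi A Q)     = refl
  appN-nilʳ (lam A Q)    = refl
  appN-nilʳ (sort s)     = refl
  appN-nilʳ (esub N A Q) = refl
  appN-nilʳ (meta α Ms)  = refl

  app?-assoc : ∀ M l₁ l₂ → (∀ l → appN M l ≡ app? M l) →
               appN (app? M l₁) l₂ ≡ app? M (catN l₁ l₂)
  app?-assoc M nil           l₂ h = h l₂
  app?-assoc M (cons N l)    l₂ h = refl
  app?-assoc M (cat l₁ l₃)   l₂ h = refl
  app?-assoc M (esubL N A l) l₂ h = sym (app?-nonNil M (NonNil-cat? l₂ nnesubL))
  app?-assoc M (metaL β Ms)  l₂ h = sym (app?-nonNil M (NonNil-cat? l₂ nnmetaL))

  appN-assoc : ∀ M l₁ l₂ → appN (appN M l₁) l₂ ≡ appN M (catN l₁ l₂)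
  appN-assoc (vapp k l₀)  l₁ l₂ = cong (vapp k) (catN-assoc l₀ l₁ l₂)
  appN-assoc (app M l₀)   l₁ l₂ = cong (app M) (catN-assoc l₀ l₁ l₂)
  appN-assoc (pi A Q)     l₁ l₂ = app?-assoc _ l₁ l₂ (λ _ → refl)
  appN-assoc (lam A Q)    l₁ l₂ = app?-assoc _ l₁ l₂ (λ _ → refl)
  appN-assoc (sort s)     l₁ l₂ = app?-assoc _ l₁ l₂ (λ _ → refl)
  appN-assoc (esub N A Q) l₁ l₂ = app?-assoc _ l₁ l₂ (λ _ → refl)
  appN-assoc (meta α Ms)  l₁ l₂ = app?-assoc _ l₁ l₂ (λ _ → refl)

  ren-cat? : ∀ ρ c l → renL ρ (cat? c l) ≡ cat? (renL ρ c) (renL ρ l)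
  ren-cat? ρ c nil           = refl
  ren-cat? ρ c (cons M l)    = refl
  ren-cat? ρ c (cat l₁ l₂)   = refl
  ren-cat? ρ c (esubL N A l) = refl
  ren-cat? ρ c (metaL β Ms)  = refl

  ren-catN : ∀ ρ l₁ l₂ → renL ρ (catN l₁ l₂) ≡ catN (renL ρ l₁) (renL ρ l₂)
  ren-catN ρ nil           l₂ = refl
  ren-catN ρ (cons M l)    l₂ = cong (cons _) (ren-catN ρ l l₂)
  ren-catN ρ (cat c d)     l₂ = cong (cat _) (ren-catN ρ d l₂)
  ren-catN ρ (esubL N A l) l₂ = ren-cat? ρ _ l₂
  ren-catN ρ (metaL β Ms)  l₂ = ren-cat? ρ _ l₂

  ren-app? : ∀ ρ M l → renT ρ (app? M l) ≡ app? (renT ρ M) (renL ρ l)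
  ren-app? ρ M nil           = refl
  ren-app? ρ M (cons N l)    = refl
  ren-app? ρ M (cat l₁ l₂)   = refl
  ren-app? ρ M (esubL N A l) = refl
  ren-app? ρ M (metaL β Ms)  = refl

  ren-appN : ∀ ρ M l → renT ρ (appN M l) ≡ appN (renT ρ M) (renL ρ l)
  ren-appN ρ (vapp k l₀)  l = cong (vapp _) (ren-catN ρ l₀ l)
  ren-appN ρ (app M l₀)   l = cong (app _) (ren-catN ρ l₀ l)
  ren-appN ρ (pi A Q)     l = ren-app? ρ _ l
  ren-appN ρ (lam A Q)    l = ren-app? ρ _ l
  ren-appN ρ (sort s)     l = ren-app? ρ _ l
  ren-appN ρ (esub N A Q) l = ren-app? ρ _ l
  ren-appN ρ (meta α Ms)  l = ren-app? ρ _ l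

  ext-cong : ∀ {ρ ρ'} → ρ ≗ ρ' → ext ρ ≗ ext ρ'
  ext-cong h zero    = refl
  ext-cong h (suc i) = cong suc (h i)

  mutual
    ren-cong : ∀ {ρ ρ'} → ρ ≗ ρ' → ∀ M → renT ρ M ≡ renT ρ' M
    ren-cong h (pi A Q)     = cong₂ pi (ren-cong h A) (ren-cong (ext-cong h) Q)
    ren-cong h (lam A Q)    = cong₂ lam (ren-cong h A) (ren-cong (ext-cong h) Q)
    ren-cong h (sort s)     = refl
    ren-cong h (vapp k l)   = cong₂ vapp (h k) (renL-cong h l)
    ren-cong h (app M l)    = cong₂ app (ren-cong h M) (renL-cong h l)
    ren-cong h (esub N A M) = cong₂ (λ u v → esub u v _) (ren-cong h N) (ren-cong h A)
                            ▸ cong (esub _ _) (ren-cong (ext-cong h) M)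
    ren-cong h (meta α Ms)  = cong (meta α) (renV-cong h Ms)

    renL-cong : ∀ {ρ ρ'} → ρ ≗ ρ' → ∀ l → renL ρ l ≡ renL ρ' l
    renL-cong h nil           = refl
    renL-cong h (cons M l)    = cong₂ cons (ren-cong h M) (renL-cong h l)
    renL-cong h (cat l₁ l₂)   = cong₂ cat (renL-cong h l₁) (renL-cong h l₂)
    renL-cong h (esubL N A l) = cong₂ (λ u v → esubL u v _) (ren-cong h N) (ren-cong h A)
                              ▸ cong (esubL _ _) (renL-cong (ext-cong h) l)
    renL-cong h (metaL β Ms)  = cong (metaL β) (renV-cong h Ms)

    renV-cong : ∀ {ρ ρ'} → ρ ≗ ρ' → ∀ {n} (Ms : Vec Term n) → renV ρ Ms ≡ renV ρ' Ms
    renV-cong h []       = refl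
    renV-cong h (M ∷ Ms) = cong₂ _∷_ (ren-cong h M) (renV-cong h Ms)

  ext-comp : ∀ ρ ρ' → (λ i → ext ρ (ext ρ' i)) ≗ ext (λ i → ρ (ρ' i))
  ext-comp ρ ρ' zero    = refl
  ext-comp ρ ρ' (suc i) = refl

  mutual
    ren-ren : ∀ ρ ρ' M → renT ρ (renT ρ' M) ≡ renT (λ i → ρ (ρ' i)) M
    ren-ren ρ ρ' (pi A Q)     = cong₂ pi (ren-ren ρ ρ' A) (ren-ren _ _ Q ▸ ren-cong (ext-comp ρ ρ') Q)
    ren-ren ρ ρ' (lam A Q)    = cong₂ lam (ren-ren ρ ρ' A) (ren-ren _ _ Q ▸ ren-cong (ext-comp ρ ρ') Q)
    ren-ren ρ ρ' (sort s)     = refl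
    ren-ren ρ ρ' (vapp k l)   = cong (vapp _) (renL-ren ρ ρ' l)
    ren-ren ρ ρ' (app M l)    = cong₂ app (ren-ren ρ ρ' M) (renL-ren ρ ρ' l)
    ren-ren ρ ρ' (esub N A M) = cong₂ (λ u v → esub u v _) (ren-ren ρ ρ' N) (ren-ren ρ ρ' A)
                              ▸ cong (esub _ _) (ren-ren _ _ M ▸ ren-cong (ext-comp ρ ρ') M)
    ren-ren ρ ρ' (meta α Ms)  = cong (meta α) (renV-ren ρ ρ' Ms)

    renL-ren : ∀ ρ ρ' l → renL ρ (renL ρ' l) ≡ renL (λ i → ρ (ρ' i)) l
    renL-ren ρ ρ' nil           = refl
    renL-ren ρ ρ' (cons M l)    = cong₂ cons (ren-ren ρ ρ' M) (renL-ren ρ ρ' l)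
    renL-ren ρ ρ' (cat l₁ l₂)   = cong₂ cat (renL-ren ρ ρ' l₁) (renL-ren ρ ρ' l₂)
    renL-ren ρ ρ' (esubL N A l) = cong₂ (λ u v → esubL u v _) (ren-ren ρ ρ' N) (ren-ren ρ ρ' A)
                                ▸ cong (esubL _ _) (renL-ren _ _ l ▸ renL-cong (ext-comp ρ ρ') l)
    renL-ren ρ ρ' (metaL β Ms)  = cong (metaL β) (renV-ren ρ ρ' Ms)

    renV-ren : ∀ ρ ρ' {n} (Ms : Vec Term n) → renV ρ (renV ρ' Ms) ≡ renV (λ i → ρ (ρ' i)) Ms
    renV-ren ρ ρ' []       = refl
    renV-ren ρ ρ' (M ∷ Ms) = cong₂ _∷_ (ren-ren ρ ρ' M) (renV-ren ρ ρ' Ms)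

  ext-id : ∀ {ρ} → ρ ≗ (λ i → i) → ext ρ ≗ (λ i → i)
  ext-id h zero    = refl
  ext-id h (suc i) = cong suc (h i)

  mutual
    ren-id : ∀ {ρ} → ρ ≗ (λ i → i) → ∀ M → renT ρ M ≡ M
    ren-id h (pi A Q)     = cong₂ pi (ren-id h A) (ren-id (ext-id h) Q)
    ren-id h (lam A Q)    = cong₂ lam (ren-id h A) (ren-id (ext-id h) Q)
    ren-id h (sort s)     = refl
    ren-id h (vapp k l)   = cong₂ vapp (h k) (renL-id h l)
    ren-id h (app M l)    = cong₂ app (ren-id h M) (renL-id h l)
    ren-id h (esub N A M) = cong₂ (λ u v → esub u v _) (ren-id h N) (ren-id h A)
                          ▸ cong (esub _ _) (ren-id (ext-id h) M)
    ren-id h (meta α Ms)  = cong (meta α) (renV-id h Ms)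

    renL-id : ∀ {ρ} → ρ ≗ (λ i → i) → ∀ l → renL ρ l ≡ l
    renL-id h nil           = refl
    renL-id h (cons M l)    = cong₂ cons (ren-id h M) (renL-id h l)
    renL-id h (cat l₁ l₂)   = cong₂ cat (renL-id h l₁) (renL-id h l₂)
    renL-id h (esubL N A l) = cong₂ (λ u v → esubL u v _) (ren-id h N) (ren-id h A)
                            ▸ cong (esubL _ _) (renL-id (ext-id h) l)
    renL-id h (metaL β Ms)  = cong (metaL β) (renV-id h Ms)

    renV-id : ∀ {ρ} → ρ ≗ (λ i → i) → ∀ {n} (Ms : Vec Term n) → renV ρ Ms ≡ Ms
    renV-id h []       = refl
    renV-id h (M ∷ Ms) = cong₂ _∷_ (ren-id h M) (renV-id h Ms)

  -- Implicit (simultaneous) substitution, which executes all x'-rules at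
  -- once: explicit substitutions are pushed into σ and concatenations and
  -- nested applications are flattened by catN and appN.  P • σ is the
  -- substitution for the binder of an explicit substitution, ids the
  -- identity and exts the lifting under a binder.
  _•_ : Term → (ℕ → Term) → ℕ → Term
  (P • σ) zero = P
  (P • σ) (suc i) = σ i

  ids : ℕ → Term
  ids i = vapp i nil

  exts : (ℕ → Term) → ℕ → Term
  exts σ zero = vapp zero nil
  exts σ (suc i) = wk (σ i)

  mutual
    sub : (ℕ → Term) → Term → Term
    sub σ (pi A Q) = pi (sub σ A) (sub (exts σ) Q)
    sub σ (lam A Q) = lam (sub σ A) (sub (exts σ) Q)
    sub σ (sort s) = sort s
    sub σ (vapp k l) = appN (σ k) (subL σ l)
    sub σ (app M l) = appN (sub σ M) (subL σ l)
    sub σ (esub N A M) = sub (sub σ N • σ) M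
    sub σ (meta k Ms) = meta k (subV σ Ms)

    subL : (ℕ → Term) → Lst → Lst
    subL σ nil = nil
    subL σ (cons M l) = cons (sub σ M) (subL σ l)
    subL σ (cat l₁ l₂) = catN (subL σ l₁) (subL σ l₂)
    subL σ (esubL N A l) = subL (sub σ N • σ) l
    subL σ (metaL k Ms) = metaL k (subV σ Ms)

    subV : ∀ {n} → (ℕ → Term) → Vec Term n → Vec Term n
    subV σ [] = []
    subV σ (M ∷ Ms) = sub σ M ∷ subV σ Ms

  nf : Term → Term
  nf = sub ids
  nfL : Lst → Lst
  nfL = subL ids

  •-cong : ∀ {σ τ} → P ≡ Q → σ ≗ τ → (P • σ) ≗ (Q • τ)
  •-cong e h zero = e
  •-cong e h (suc i) = h i

  exts-cong : ∀ {σ τ} → σ ≗ τ → exts σ ≗ exts τ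
  exts-cong h zero = refl
  exts-cong h (suc i) = cong wk (h i)

  mutual
    sub-cong : ∀ {σ τ} → σ ≗ τ → ∀ M → sub σ M ≡ sub τ M
    sub-cong h (pi A Q) = cong₂ pi (sub-cong h A) (sub-cong (exts-cong h) Q)
    sub-cong h (lam A Q) = cong₂ lam (sub-cong h A) (sub-cong (exts-cong h) Q)
    sub-cong h (sort s) = refl
    sub-cong h (vapp k l) = cong₂ appN (h k) (subL-cong h l)
    sub-cong h (app M l) = cong₂ appN (sub-cong h M) (subL-cong h l)
    sub-cong h (esub N A M) = sub-cong (•-cong (sub-cong h N) h) M
    sub-cong h (meta k Ms) = cong (meta k) (subV-cong h Ms)

    subL-cong : ∀ {σ τ} → σ ≗ τ → ∀ l → subL σ l ≡ subL τ l
    subL-cong h nil = refl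
    subL-cong h (cons M l) = cong₂ cons (sub-cong h M) (subL-cong h l)
    subL-cong h (cat l₁ l₂) = cong₂ catN (subL-cong h l₁) (subL-cong h l₂)
    subL-cong h (esubL N A l) = subL-cong (•-cong (sub-cong h N) h) l
    subL-cong h (metaL k Ms) = cong (metaL k) (subV-cong h Ms)

    subV-cong : ∀ {σ τ} → σ ≗ τ → ∀ {n} (Ms : Vec Term n) → subV σ Ms ≡ subV τ Ms
    subV-cong h [] = refl
    subV-cong h (M ∷ Ms) = cong₂ _∷_ (sub-cong h M) (subV-cong h Ms)

  •-map : ∀ (f : Term → Term) {σ} → f P ≡ Q → (λ i → f ((P • σ) i)) ≗ (Q • (λ i → f (σ i)))
  •-map f e zero = e
  •-map f e (suc i) = refl

  exts-ren : ∀ ρ σ → (λ i → renT (ext ρ) (exts σ i)) ≗ exts (λ i → renT ρ (σ i))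
  exts-ren ρ σ zero = refl
  exts-ren ρ σ (suc i) = ren-ren (ext ρ) suc (σ i) ▸ sym (ren-ren suc ρ (σ i))

  mutual
    ren-sub : ∀ ρ σ M → renT ρ (sub σ M) ≡ sub (λ i → renT ρ (σ i)) M
    ren-sub ρ σ (pi A Q) = cong₂ pi (ren-sub ρ σ A) (ren-sub (ext ρ) (exts σ) Q ▸ sub-cong (exts-ren ρ σ) Q)
    ren-sub ρ σ (lam A Q) = cong₂ lam (ren-sub ρ σ A) (ren-sub (ext ρ) (exts σ) Q ▸ sub-cong (exts-ren ρ σ) Q)
    ren-sub ρ σ (sort s) = refl
    ren-sub ρ σ (vapp k l) = ren-appN ρ (σ k) (subL σ l) ▸ cong (appN (renT ρ (σ k))) (renL-sub ρ σ l)
    ren-sub ρ σ (app M l) = ren-appN ρ (sub σ M) (subL σ l) ▸ cong₂ appN (ren-sub ρ σ M) (renL-sub ρ σ l)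
    ren-sub ρ σ (esub N A M) = ren-sub ρ _ M ▸ sub-cong (•-map (renT ρ) (ren-sub ρ σ N)) M
    ren-sub ρ σ (meta k Ms) = cong (meta k) (renV-sub ρ σ Ms)

    renL-sub : ∀ ρ σ l → renL ρ (subL σ l) ≡ subL (λ i → renT ρ (σ i)) l
    renL-sub ρ σ nil = refl
    renL-sub ρ σ (cons M l) = cong₂ cons (ren-sub ρ σ M) (renL-sub ρ σ l)
    renL-sub ρ σ (cat l₁ l₂) = ren-catN ρ (subL σ l₁) (subL σ l₂)
      ▸ cong₂ catN (renL-sub ρ σ l₁) (renL-sub ρ σ l₂)
    renL-sub ρ σ (esubL N A l) = renL-sub ρ _ l ▸ subL-cong (•-map (renT ρ) (ren-sub ρ σ N)) l
    renL-sub ρ σ (metaL k Ms) = cong (metaL k) (renV-sub ρ σ Ms)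

    renV-sub : ∀ ρ σ {n} (Ms : Vec Term n) → renV ρ (subV σ Ms) ≡ subV (λ i → renT ρ (σ i)) Ms
    renV-sub ρ σ [] = refl
    renV-sub ρ σ (M ∷ Ms) = cong₂ _∷_ (ren-sub ρ σ M) (renV-sub ρ σ Ms)

  •-ext : ∀ {σ ρ} → P ≡ Q → (λ i → (P • σ) (ext ρ i)) ≗ (Q • (λ i → σ (ρ i)))
  •-ext e zero    = e
  •-ext e (suc i) = refl

  exts-ext : ∀ σ ρ → (λ i → exts σ (ext ρ i)) ≗ exts (λ i → σ (ρ i))
  exts-ext σ ρ zero = refl
  exts-ext σ ρ (suc i) = refl

  mutual
    sub-ren : ∀ σ ρ M → sub σ (renT ρ M) ≡ sub (λ i → σ (ρ i)) M
    sub-ren σ ρ (pi A Q) = cong₂ pi (sub-ren σ ρ A) (sub-ren (exts σ) (ext ρ) Q ▸ sub-cong (exts-ext σ ρ) Q)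
    sub-ren σ ρ (lam A Q) = cong₂ lam (sub-ren σ ρ A) (sub-ren (exts σ) (ext ρ) Q ▸ sub-cong (exts-ext σ ρ) Q)
    sub-ren σ ρ (sort s) = refl
    sub-ren σ ρ (vapp k l) = cong (appN (σ (ρ k))) (subL-ren σ ρ l)
    sub-ren σ ρ (app M l) = cong₂ appN (sub-ren σ ρ M) (subL-ren σ ρ l)
    sub-ren σ ρ (esub N A M) = sub-ren _ (ext ρ) M ▸ sub-cong (•-ext (sub-ren σ ρ N)) M
    sub-ren σ ρ (meta k Ms) = cong (meta k) (subV-ren σ ρ Ms)

    subL-ren : ∀ σ ρ l → subL σ (renL ρ l) ≡ subL (λ i → σ (ρ i)) l
    subL-ren σ ρ nil = refl
    subL-ren σ ρ (cons M l) = cong₂ cons (sub-ren σ ρ M) (subL-ren σ ρ l)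
    subL-ren σ ρ (cat l₁ l₂) = cong₂ catN (subL-ren σ ρ l₁) (subL-ren σ ρ l₂)
    subL-ren σ ρ (esubL N A l) = subL-ren _ (ext ρ) l ▸ subL-cong (•-ext (sub-ren σ ρ N)) l
    subL-ren σ ρ (metaL k Ms) = cong (metaL k) (subV-ren σ ρ Ms)

    subV-ren : ∀ σ ρ {n} (Ms : Vec Term n) → subV σ (renV ρ Ms) ≡ subV (λ i → σ (ρ i)) Ms
    subV-ren σ ρ [] = refl
    subV-ren σ ρ (M ∷ Ms) = cong₂ _∷_ (sub-ren σ ρ M) (subV-ren σ ρ Ms)

  sub-cat? : ∀ σ c l → subL σ (cat? c l) ≡ catN (subL σ c) (subL σ l)
  sub-cat? σ c nil = sym (catN-nilʳ _)
  sub-cat? σ c (cons M l) = refl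
  sub-cat? σ c (cat l₁ l₂) = refl
  sub-cat? σ c (esubL N A l) = refl
  sub-cat? σ c (metaL k Ms) = refl

  sub-catN : ∀ σ l₁ l₂ → subL σ (catN l₁ l₂) ≡ catN (subL σ l₁) (subL σ l₂)
  sub-catN σ nil l₂ = refl
  sub-catN σ (cons M l) l₂ = cong (cons _) (sub-catN σ l l₂)
  sub-catN σ (cat c d) l₂ = cong (catN (subL σ c)) (sub-catN σ d l₂) ▸ sym (catN-assoc (subL σ c) _ _)
  sub-catN σ (esubL N A l) l₂ = sub-cat? σ _ l₂
  sub-catN σ (metaL k Ms) l₂ = sub-cat? σ _ l₂

  sub-app? : ∀ σ M l → sub σ (app? M l) ≡ appN (sub σ M) (subL σ l)
  sub-app? σ M nil = sym (appN-nilʳ _)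
  sub-app? σ M (cons N l) = refl
  sub-app? σ M (cat l₁ l₂) = refl
  sub-app? σ M (esubL N A l) = refl
  sub-app? σ M (metaL k Ms) = refl

  sub-appN : ∀ σ M l → sub σ (appN M l) ≡ appN (sub σ M) (subL σ l)
  sub-appN σ (vapp k l₀) l = cong (appN (σ k)) (sub-catN σ l₀ l) ▸ sym (appN-assoc (σ k) _ _)
  sub-appN σ (app M l₀) l = cong (appN (sub σ M)) (sub-catN σ l₀ l) ▸ sym (appN-assoc (sub σ M) _ _)
  sub-appN σ (pi A Q) l = sub-app? σ _ l
  sub-appN σ (lam A Q) l = sub-app? σ _ l
  sub-appN σ (sort s) l = sub-app? σ _ l
  sub-appN σ (esub N A Q) l = sub-app? σ _ l
  sub-appN σ (meta k Ms) l = sub-app? σ _ l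

  exts-sub : ∀ σ τ → (λ i → sub (exts σ) (exts τ i)) ≗ exts (λ i → sub σ (τ i))
  exts-sub σ τ zero = refl
  exts-sub σ τ (suc i) = sub-ren (exts σ) suc (τ i) ▸ sym (ren-sub suc σ (τ i))

  mutual
    sub-sub : ∀ σ τ M → sub σ (sub τ M) ≡ sub (λ i → sub σ (τ i)) M
    sub-sub σ τ (pi A Q) = cong₂ pi (sub-sub σ τ A) (sub-sub (exts σ) (exts τ) Q ▸ sub-cong (exts-sub σ τ) Q)
    sub-sub σ τ (lam A Q) = cong₂ lam (sub-sub σ τ A) (sub-sub (exts σ) (exts τ) Q
      ▸ sub-cong (exts-sub σ τ) Q)
    sub-sub σ τ (sort s) = refl
    sub-sub σ τ (vapp k l) = sub-appN σ (τ k) (subL τ l) ▸ cong (appN (sub σ (τ k))) (subL-sub σ τ l)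
    sub-sub σ τ (app M l) = sub-appN σ (sub τ M) (subL τ l) ▸ cong₂ appN (sub-sub σ τ M) (subL-sub σ τ l)
    sub-sub σ τ (esub N A M) = sub-sub σ _ M ▸ sub-cong (•-map (sub σ) (sub-sub σ τ N)) M
    sub-sub σ τ (meta k Ms) = cong (meta k) (subV-sub σ τ Ms)

    subL-sub : ∀ σ τ l → subL σ (subL τ l) ≡ subL (λ i → sub σ (τ i)) l
    subL-sub σ τ nil = refl
    subL-sub σ τ (cons M l) = cong₂ cons (sub-sub σ τ M) (subL-sub σ τ l)
    subL-sub σ τ (cat l₁ l₂) = sub-catN σ (subL τ l₁) (subL τ l₂)
      ▸ cong₂ catN (subL-sub σ τ l₁) (subL-sub σ τ l₂)
    subL-sub σ τ (esubL N A l) = subL-sub σ _ l ▸ subL-cong (•-map (sub σ) (sub-sub σ τ N)) l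
    subL-sub σ τ (metaL k Ms) = cong (metaL k) (subV-sub σ τ Ms)

    subV-sub : ∀ σ τ {n} (Ms : Vec Term n) → subV σ (subV τ Ms) ≡ subV (λ i → sub σ (τ i)) Ms
    subV-sub σ τ [] = refl
    subV-sub σ τ (M ∷ Ms) = cong₂ _∷_ (sub-sub σ τ M) (subV-sub σ τ Ms)

  -- Invariance (ii): every x'-step leaves sub σ unchanged.  For the rules
  -- C1, C5 this needs that the swap of the two innermost variables is undone
  -- by the substitution; for A3, A4, B1-B3 the monoid laws of catN, appN.
  subV-map : ∀ σ P G {n} (Ms : Vec Term n) → subV σ (map (esub P G) Ms) ≡ subV (sub σ P • σ) Ms
  subV-map σ P G [] = refl
  subV-map σ P G (M ∷ Ms) = cong (_ ∷_) (subV-map σ P G Ms)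

  swap-sub : ∀ σ P → (λ i → (sub (exts σ) (wk P) • exts σ) (swap01 i)) ≗ exts (sub σ P • σ)
  swap-sub σ P zero = refl
  swap-sub σ P (suc zero) = sub-ren (exts σ) suc P ▸ sym (ren-sub suc σ P)
  swap-sub σ P (suc (suc j)) = refl

  sub-XT-invariant : ∀ {M N} → XT M N → ∀ σ → sub σ M ≡ sub σ N
  sub-XT-invariant (B1 {M}) σ = appN-nilʳ (sub σ M)
  sub-XT-invariant (B2 {k} {l} {l'}) σ = appN-assoc (σ k) (subL σ l) (subL σ l')
  sub-XT-invariant (B3 {M} {l} {l'}) σ = appN-assoc (sub σ M) (subL σ l) (subL σ l')
  sub-XT-invariant (C1 {P} {G} {A} {M}) σ = cong (lam _) (sym (sub-ren _ swap01 M
    ▸ sub-cong (swap-sub σ P) M))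
  sub-XT-invariant C2 σ = refl
  sub-XT-invariant C3 σ = refl
  sub-XT-invariant C4 σ = refl
  sub-XT-invariant (C5 {P} {G} {A} {M}) σ = cong (pi _) (sym (sub-ren _ swap01 M ▸ sub-cong (swap-sub σ P) M))
  sub-XT-invariant C6 σ = refl
  sub-XT-invariant (Cα {P} {G} {k} {Ms}) σ = cong (meta k) (sym (subV-map σ P G Ms))

  subL-XL-invariant : ∀ {l l'} → XL l l' → ∀ σ → subL σ l ≡ subL σ l'
  subL-XL-invariant A1 σ = refl
  subL-XL-invariant A2 σ = refl
  subL-XL-invariant (A3 {l} {l'} {l''}) σ = catN-assoc (subL σ l) (subL σ l') (subL σ l'')
  subL-XL-invariant (A4 {l}) σ = catN-nilʳ (subL σ l)
  subL-XL-invariant D1 σ = refl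
  subL-XL-invariant D2 σ = refl
  subL-XL-invariant D3 σ = refl
  subL-XL-invariant (Dβ {P} {G} {k} {Ms}) σ = cong (metaL k) (sym (subV-map σ P G Ms))

  mutual
    sub-x'-invariant : ∀ {M N} → M X'.⟶t N → ∀ σ → sub σ M ≡ sub σ N
    sub-x'-invariant (X'.root r) σ = sub-XT-invariant r σ
    sub-x'-invariant (X'.piˡ d) σ = cong (λ u → pi u _) (sub-x'-invariant d σ)
    sub-x'-invariant (X'.piʳ d) σ = cong (pi _) (sub-x'-invariant d (exts σ))
    sub-x'-invariant (X'.lamˡ d) σ = cong (λ u → lam u _) (sub-x'-invariant d σ)
    sub-x'-invariant (X'.lamʳ d) σ = cong (lam _) (sub-x'-invariant d (exts σ))
    sub-x'-invariant (X'.vappʳ {k} d) σ = cong (appN (σ k)) (subL-x'-invariant d σ)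
    sub-x'-invariant (X'.appˡ {l = l} d) σ = cong (λ u → appN u (subL σ l)) (sub-x'-invariant d σ)
    sub-x'-invariant (X'.appʳ {M} d) σ = cong (appN (sub σ M)) (subL-x'-invariant d σ)
    sub-x'-invariant (X'.esub₁ {M = M} d) σ = cong (λ u → sub (u • σ) M) (sub-x'-invariant d σ)
    sub-x'-invariant (X'.esub₂ d) σ = refl
    sub-x'-invariant (X'.esub₃ {N} d) σ = sub-x'-invariant d (sub σ N • σ)
    sub-x'-invariant (X'.metaᶜ {k} d) σ = cong (meta k) (subV-x'-invariant d σ)

    subL-x'-invariant : ∀ {l l'} → l X'.⟶l l' → ∀ σ → subL σ l ≡ subL σ l'
    subL-x'-invariant (X'.root r) σ = subL-XL-invariant r σ
    subL-x'-invariant (X'.consˡ d) σ = cong (λ u → cons u _) (sub-x'-invariant d σ)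
    subL-x'-invariant (X'.consʳ d) σ = cong (cons _) (subL-x'-invariant d σ)
    subL-x'-invariant (X'.catˡ {l₂ = l₂} d) σ = cong (λ u → catN u (subL σ l₂)) (subL-x'-invariant d σ)
    subL-x'-invariant (X'.catʳ {l₁} d) σ = cong (catN (subL σ l₁)) (subL-x'-invariant d σ)
    subL-x'-invariant (X'.esubL₁ {l = l} d) σ = cong (λ u → subL (u • σ) l) (sub-x'-invariant d σ)
    subL-x'-invariant (X'.esubL₂ d) σ = refl
    subL-x'-invariant (X'.esubL₃ {N} d) σ = subL-x'-invariant d (sub σ N • σ)
    subL-x'-invariant (X'.metaLᶜ {k} d) σ = cong (metaL k) (subV-x'-invariant d σ)

    subV-x'-invariant : ∀ {n} {Ms Ms' : Vec Term n} → Ms X'.⟶v Ms' → ∀ σ → subV σ Ms ≡ subV σ Ms'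
    subV-x'-invariant (X'.here d) σ = cong (λ u → u ∷ _) (sub-x'-invariant d σ)
    subV-x'-invariant (X'.there d) σ = cong (_ ∷_) (subV-x'-invariant d σ)


  data Head : Term → Set where
    hpi : Head (pi A Q)
    hlam : Head (lam A Q)
    hsort : ∀ {s} → Head (sort s)
    hmeta : ∀ {k} {Ms : Vec Term (arT k)} → Head (meta k Ms)

  mutual
    data Nf : Term → Set where
      npi : Nf A → Nf Q → Nf (pi A Q)
      nlam : Nf A → Nf Q → Nf (lam A Q)
      nsort : ∀ {s} → Nf (sort s)
      nvapp : ∀ {k} → NfL l → Nf (vapp k l)
      napp : Head M → NonNil l → Nf M → NfL l → Nf (app M l)
      nmeta : ∀ {k} {Ms : Vec Term (arT k)} → NfV Ms → Nf (meta k Ms)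

    data NfL : Lst → Set where
      nnil : NfL nil
      ncons : Nf M → NfL l → NfL (cons M l)
      ncat : ∀ {k} {Ms : Vec Term (arL k)} → NfV Ms → NonNil l → NfL l → NfL (cat (metaL k Ms) l)
      nmetaL : ∀ {k} {Ms : Vec Term (arL k)} → NfV Ms → NfL (metaL k Ms)

    data NfV : ∀ {n} → Vec Term n → Set where
      n[] : NfV []
      _n∷_ : ∀ {n} {Ms : Vec Term n} → Nf M → NfV Ms → NfV (M ∷ Ms)

  -- Normal forms are stable under renaming (needed to lift NfS under binders).
  Head-ren : ∀ ρ → Head M → Head (renT ρ M)
  Head-ren ρ hpi = hpi
  Head-ren ρ hlam = hlam
  Head-ren ρ hsort = hsort
  Head-ren ρ hmeta = hmeta

  NonNil-ren : ∀ ρ → NonNil l → NonNil (renL ρ l)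
  NonNil-ren ρ nncons = nncons
  NonNil-ren ρ nncat = nncat
  NonNil-ren ρ nnesubL = nnesubL
  NonNil-ren ρ nnmetaL = nnmetaL

  mutual
    Nf-ren : ∀ ρ → Nf M → Nf (renT ρ M)
    Nf-ren ρ (npi a b) = npi (Nf-ren ρ a) (Nf-ren (ext ρ) b)
    Nf-ren ρ (nlam a b) = nlam (Nf-ren ρ a) (Nf-ren (ext ρ) b)
    Nf-ren ρ nsort = nsort
    Nf-ren ρ (nvapp h) = nvapp (NfL-ren ρ h)
    Nf-ren ρ (napp hd nn a h) = napp (Head-ren ρ hd) (NonNil-ren ρ nn) (Nf-ren ρ a) (NfL-ren ρ h)
    Nf-ren ρ (nmeta v) = nmeta (NfV-ren ρ v)

    NfL-ren : ∀ ρ → NfL l → NfL (renL ρ l)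
    NfL-ren ρ nnil = nnil
    NfL-ren ρ (ncons a h) = ncons (Nf-ren ρ a) (NfL-ren ρ h)
    NfL-ren ρ (ncat v nn h) = ncat (NfV-ren ρ v) (NonNil-ren ρ nn) (NfL-ren ρ h)
    NfL-ren ρ (nmetaL v) = nmetaL (NfV-ren ρ v)

    NfV-ren : ∀ ρ {n} {Ms : Vec Term n} → NfV Ms → NfV (renV ρ Ms)
    NfV-ren ρ n[] = n[]
    NfV-ren ρ (a n∷ v) = Nf-ren ρ a n∷ NfV-ren ρ v

  NfL-cat?-meta : ∀ {k} {Ms : Vec Term (arL k)} → NfV Ms → NfL l → NfL (cat? (metaL k Ms) l)
  NfL-cat?-meta v nnil = nmetaL v
  NfL-cat?-meta v (ncons a h) = ncat v nncons (ncons a h)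
  NfL-cat?-meta v (ncat w nn h) = ncat v nncat (ncat w nn h)
  NfL-cat?-meta v (nmetaL w) = ncat v nnmetaL (nmetaL w)

  NfL-catN : NfL l₁ → NfL l₂ → NfL (catN l₁ l₂)
  NfL-catN nnil h₂ = h₂
  NfL-catN (ncons a h) h₂ = ncons a (NfL-catN h h₂)
  NfL-catN {l₂ = l₂} (ncat v nn h) h₂ = ncat v (NonNil-catN l₂ nn) (NfL-catN h h₂)
  NfL-catN (nmetaL v) h₂ = NfL-cat?-meta v h₂

  Nf-app? : Head M → Nf M → NfL l → Nf (app? M l)
  Nf-app? hd a nnil = a
  Nf-app? hd a (ncons b h) = napp hd nncons a (ncons b h)
  Nf-app? hd a (ncat v nn h) = napp hd nncat a (ncat v nn h)
  Nf-app? hd a (nmetaL v) = napp hd nnmetaL a (nmetaL v)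

  Nf-appN : Nf M → NfL l → Nf (appN M l)
  Nf-appN (npi a b) h = Nf-app? hpi (npi a b) h
  Nf-appN (nlam a b) h = Nf-app? hlam (nlam a b) h
  Nf-appN nsort h = Nf-app? hsort nsort h
  Nf-appN (nvapp h₀) h = nvapp (NfL-catN h₀ h)
  Nf-appN {l = l} (napp hd nn a h₀) h = napp hd (NonNil-catN l nn) a (NfL-catN h₀ h)
  Nf-appN (nmeta v) h = Nf-app? hmeta (nmeta v) h

  NfS : (ℕ → Term) → Set
  NfS σ = ∀ i → Nf (σ i)

  Nf-exts : ∀ {σ} → NfS σ → NfS (exts σ)
  Nf-exts h zero = nvapp nnil
  Nf-exts h (suc i) = Nf-ren suc (h i)

  Nf-• : ∀ {σ} → Nf P → NfS σ → NfS (P • σ)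
  Nf-• a h zero = a
  Nf-• a h (suc i) = h i

  Nf-ids : NfS ids
  Nf-ids i = nvapp nnil

  mutual
    Nf-sub : ∀ {σ} → NfS σ → ∀ M → Nf (sub σ M)
    Nf-sub h (pi A Q) = npi (Nf-sub h A) (Nf-sub (Nf-exts h) Q)
    Nf-sub h (lam A Q) = nlam (Nf-sub h A) (Nf-sub (Nf-exts h) Q)
    Nf-sub h (sort s) = nsort
    Nf-sub h (vapp k l) = Nf-appN (h k) (NfL-sub h l)
    Nf-sub h (app M l) = Nf-appN (Nf-sub h M) (NfL-sub h l)
    Nf-sub h (esub N A M) = Nf-sub (Nf-• (Nf-sub h N) h) M
    Nf-sub h (meta k Ms) = nmeta (NfV-sub h Ms)

    NfL-sub : ∀ {σ} → NfS σ → ∀ l → NfL (subL σ l)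
    NfL-sub h nil = nnil
    NfL-sub h (cons M l) = ncons (Nf-sub h M) (NfL-sub h l)
    NfL-sub h (cat l₁ l₂) = NfL-catN (NfL-sub h l₁) (NfL-sub h l₂)
    NfL-sub h (esubL N A l) = NfL-sub (Nf-• (Nf-sub h N) h) l
    NfL-sub h (metaL k Ms) = nmetaL (NfV-sub h Ms)

    NfV-sub : ∀ {σ} → NfS σ → ∀ {n} (Ms : Vec Term n) → NfV (subV σ Ms)
    NfV-sub h [] = n[]
    NfV-sub h (M ∷ Ms) = Nf-sub h M n∷ NfV-sub h Ms

  _↠x'_ : Term → Term → Set
  _↠x'_ = Star X'._⟶t_
  _↠x'ˡ_ : Lst → Lst → Set
  _↠x'ˡ_ = Star X'._⟶l_
  _↠x'ᵛ_ : ∀ {n} → Vec Term n → Vec Term n → Set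
  _↠x'ᵛ_ = Star X'._⟶v_

  cat↠cat? : ∀ c l₂ → cat c l₂ ↠x'ˡ cat? c l₂
  cat↠cat? c nil = X'.root A4 ◅ ε
  cat↠cat? c (cons M l) = ε
  cat↠cat? c (cat l₁ l₃) = ε
  cat↠cat? c (esubL N A l) = ε
  cat↠cat? c (metaL k Ms) = ε

  cat↠catN : ∀ l₁ l₂ → cat l₁ l₂ ↠x'ˡ catN l₁ l₂
  cat↠catN nil l₂ = X'.root A2 ◅ ε
  cat↠catN (cons M l) l₂ = X'.root A1 ◅ gmap (cons M) X'.consʳ (cat↠catN l l₂)
  cat↠catN (cat c d) l₂ = X'.root A3 ◅ gmap (cat c) X'.catʳ (cat↠catN d l₂)
  cat↠catN (esubL N A l) l₂ = cat↠cat? _ l₂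
  cat↠catN (metaL k Ms) l₂ = cat↠cat? _ l₂

  app↠app? : ∀ M l → app M l ↠x' app? M l
  app↠app? M nil = X'.root B1 ◅ ε
  app↠app? M (cons N l) = ε
  app↠app? M (cat l₁ l₂) = ε
  app↠app? M (esubL N A l) = ε
  app↠app? M (metaL k Ms) = ε

  app↠appN : ∀ M l → app M l ↠x' appN M l
  app↠appN (vapp k l₀) l = X'.root B2 ◅ gmap (vapp k) X'.vappʳ (cat↠catN l₀ l)
  app↠appN (app M l₀) l = X'.root B3 ◅ gmap (app M) X'.appʳ (cat↠catN l₀ l)
  app↠appN (pi A Q) l = app↠app? _ l
  app↠appN (lam A Q) l = app↠app? _ l
  app↠appN (sort s) l = app↠app? _ l
  app↠appN (esub N A Q) l = app↠app? _ l
  app↠appN (meta k Ms) l = app↠app? _ l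

  -- Pushing ⟨P/x⟩ under a binder (rules C1, C5) swaps the two innermost
  -- variables; the implicit substitution absorbs the swap.
  swap-ids : ∀ P → (λ z → (wk P • ids) (swap01 z)) ≗ exts (P • ids)
  swap-ids P zero = refl
  swap-ids P (suc zero) = refl
  swap-ids P (suc (suc j)) = refl

  swap-ids-ren : ∀ P ρ Q → sub (wk P • ids) (renT (λ i → swap01 (ext ρ i)) Q) ≡ sub (exts (P • ids)) (renT (ext ρ) Q)
  swap-ids-ren P ρ Q = sub-ren _ _ Q ▸ sub-cong (λ i → swap-ids P (ext ρ i)) Q ▸ sym (sub-ren _ _ Q)

  push-esub-var : ∀ {P G} j l' → esubL P G l' ↠x'ˡ subL (P • ids) l' →
       esub P G (vapp j l') ↠x' appN ((P • ids) j) (subL (P • ids) l')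
  push-esub-var {P} zero l' h = X'.root C2 ◅ (gmap (app P) X'.appʳ h ◅◅ app↠appN P _)
  push-esub-var (suc j) l' h = X'.root C3 ◅ gmap (vapp j) X'.vappʳ h

  -- The statement is generalised over a renaming ρ because rules C1, C5
  -- rename the body; induction is on the normal-form derivation of M.
  mutual
    push-esub : Nf M → ∀ ρ P G → esub P G (renT ρ M) ↠x' sub (P • ids) (renT ρ M)
    push-esub (npi a b) ρ P G =
      X'.root C5 ◅ (gmap (λ u → pi u _) X'.piˡ (push-esub a ρ P G)
                 ◅◅ gmap (pi _) X'.piʳ (push-esub-under b ρ P G))
    push-esub (nlam a b) ρ P G =
      X'.root C1 ◅ (gmap (λ u → lam u _) X'.lamˡ (push-esub a ρ P G)
                 ◅◅ gmap (lam _) X'.lamʳ (push-esub-under b ρ P G))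
    push-esub nsort ρ P G = X'.root C6 ◅ ε
    push-esub (nvapp {l} {k} h) ρ P G = push-esub-var (ρ k) (renL ρ l) (push-esubL h ρ P G)
    push-esub (napp hd nn a h) ρ P G =
      X'.root C4 ◅ (gmap (λ u → app u _) X'.appˡ (push-esub a ρ P G)
                 ◅◅ gmap (app _) X'.appʳ (push-esubL h ρ P G)
                 ◅◅ app↠appN _ _)
    push-esub (nmeta {k} v) ρ P G = X'.root Cα ◅ gmap (meta k) X'.metaᶜ (push-esubV v ρ P G)

    push-esub-under : Nf Q → ∀ ρ P G →
      esub (wk P) (wk G) (renT swap01 (renT (ext ρ) Q)) ↠x' sub (exts (P • ids)) (renT (ext ρ) Q)
    push-esub-under {Q} b ρ P G =
      cast (cong (esub _ _) (sym (ren-ren swap01 (ext ρ) Q))) (swap-ids-ren P ρ Q)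
           (push-esub b (λ i → swap01 (ext ρ i)) (wk P) (wk G))

    push-esubL : NfL l → ∀ ρ P G → esubL P G (renL ρ l) ↠x'ˡ subL (P • ids) (renL ρ l)
    push-esubL nnil ρ P G = X'.root D1 ◅ ε
    push-esubL (ncons a h) ρ P G =
      X'.root D2 ◅ (gmap (λ u → cons u _) X'.consˡ (push-esub a ρ P G)
                 ◅◅ gmap (cons _) X'.consʳ (push-esubL h ρ P G))
    push-esubL (ncat {k = k} v nn h) ρ P G =
      X'.root D3 ◅ X'.catˡ (X'.root Dβ)
                 ◅ (gmap (λ u → cat (metaL k u) _) (λ d → X'.catˡ (X'.metaLᶜ d)) (push-esubV v ρ P G)
                 ◅◅ gmap (cat _) X'.catʳ (push-esubL h ρ P G)
                 ◅◅ cat↠catN _ _)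
    push-esubL (nmetaL {k} v) ρ P G = X'.root Dβ ◅ gmap (metaL k) X'.metaLᶜ (push-esubV v ρ P G)

    push-esubV : ∀ {n} {Ms : Vec Term n} → NfV Ms → ∀ ρ P G →
                 map (esub P G) (renV ρ Ms) ↠x'ᵛ subV (P • ids) (renV ρ Ms)
    push-esubV n[] ρ P G = ε
    push-esubV (a n∷ v) ρ P G =
      gmap (λ u → u ∷ _) X'.here (push-esub a ρ P G) ◅◅ gmap (_ ∷_) X'.there (push-esubV v ρ P G)

  push-esub-nf : Nf M → ∀ P G → esub P G M ↠x' sub (P • ids) M
  push-esub-nf {M} a P G =
    cast (cong (esub P G) renT-id) (cong (sub (P • ids)) renT-id) (push-esub a (λ i → i) P G)
    where
    renT-id : renT (λ i → i) M ≡ M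
    renT-id = ren-id (λ _ → refl) M

  push-esubL-nf : NfL l → ∀ P G → esubL P G l ↠x'ˡ subL (P • ids) l
  push-esubL-nf {l} a P G =
    cast (cong (esubL P G) renL-id₀) (cong (subL (P • ids)) renL-id₀) (push-esubL a (λ i → i) P G)
    where
    renL-id₀ : renL (λ i → i) l ≡ l
    renL-id₀ = renL-id (λ _ → refl) l

  exts-ids : exts ids ≗ ids
  exts-ids zero = refl
  exts-ids (suc i) = refl

  sub-ids-after : ∀ σ → (λ i → sub σ (ids i)) ≗ σ
  sub-ids-after σ i = appN-nilʳ (σ i)

  nf-esub : ∀ P M → sub (P • ids) (nf M) ≡ sub (P • ids) M
  nf-esub P M = sub-sub _ ids M ▸ sub-cong (sub-ids-after (P • ids)) M
  nfL-esub : ∀ P l → subL (P • ids) (nfL l) ≡ subL (P • ids) l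
  nfL-esub P l = subL-sub _ ids l ▸ subL-cong (sub-ids-after (P • ids)) l

  mutual
    reach-nf : ∀ M → M ↠x' nf M
    reach-nf (pi A Q) =
      gmap (λ u → pi u Q) X'.piˡ (reach-nf A)
      ◅◅ gmap (pi _) X'.piʳ (cast refl (sym (sub-cong exts-ids Q)) (reach-nf Q))
    reach-nf (lam A Q) =
      gmap (λ u → lam u Q) X'.lamˡ (reach-nf A)
      ◅◅ gmap (lam _) X'.lamʳ (cast refl (sym (sub-cong exts-ids Q)) (reach-nf Q))
    reach-nf (sort s) = ε
    reach-nf (vapp k l) = gmap (vapp k) X'.vappʳ (reach-nfL l)
    reach-nf (app M l) =
      gmap (λ u → app u l) X'.appˡ (reach-nf M)
      ◅◅ gmap (app _) X'.appʳ (reach-nfL l)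
      ◅◅ app↠appN _ _
    reach-nf (esub N A M) =
      gmap (λ u → esub u A M) X'.esub₁ (reach-nf N)
      ◅◅ gmap (esub _ A) X'.esub₃ (reach-nf M)
      ◅◅ cast refl (nf-esub (nf N) M) (push-esub-nf (Nf-sub Nf-ids M) (nf N) A)
    reach-nf (meta k Ms) = gmap (meta k) X'.metaᶜ (reach-nfV Ms)

    reach-nfL : ∀ l → l ↠x'ˡ nfL l
    reach-nfL nil = ε
    reach-nfL (cons M l) =
      gmap (λ u → cons u l) X'.consˡ (reach-nf M) ◅◅ gmap (cons _) X'.consʳ (reach-nfL l)
    reach-nfL (cat l₁ l₂) =
      gmap (λ u → cat u l₂) X'.catˡ (reach-nfL l₁)
      ◅◅ gmap (cat _) X'.catʳ (reach-nfL l₂)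
      ◅◅ cat↠catN _ _
    reach-nfL (esubL N A l) =
      gmap (λ u → esubL u A l) X'.esubL₁ (reach-nf N)
      ◅◅ gmap (esubL _ A) X'.esubL₃ (reach-nfL l)
      ◅◅ cast refl (nfL-esub (nf N) l) (push-esubL-nf (NfL-sub Nf-ids l) (nf N) A)
    reach-nfL (metaL k Ms) = gmap (metaL k) X'.metaLᶜ (reach-nfV Ms)

    reach-nfV : ∀ {n} (Ms : Vec Term n) → Ms ↠x'ᵛ subV ids Ms
    reach-nfV [] = ε
    reach-nfV (M ∷ Ms) =
      gmap (λ u → u ∷ Ms) X'.here (reach-nf M) ◅◅ gmap (_ ∷_) X'.there (reach-nfV Ms)

  x'-confluent : Confluent _⟶x'_
  x'-confluent = confluent-by-normaliser _ nf reach-nf (λ d → sub-x'-invariant d ids)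

  x'ˡ-confluent : Confluent _⟶x'ˡ_
  x'ˡ-confluent = confluent-by-normaliser _ nfL reach-nfL (λ d → subL-x'-invariant d ids)

  infix 4 _⇛_ _⇛l_ _⇛v_
  mutual
    data _⇛_ : Term → Term → Set where
      ppi : A ⇛ A' → Q ⇛ Q' → pi A Q ⇛ pi A' Q'
      plam : A ⇛ A' → Q ⇛ Q' → lam A Q ⇛ lam A' Q'
      psort : ∀ {s} → sort s ⇛ sort s
      pvapp : ∀ {k} → l ⇛l l' → vapp k l ⇛ vapp k l'
      papp : M ⇛ M' → l ⇛l l' → app M l ⇛ app M' l'
      pesub : N ⇛ N' → A ⇛ A' → M ⇛ M' → esub N A M ⇛ esub N' A' M'
      pmeta : ∀ {k} {Ms Ms' : Vec Term (arT k)} → Ms ⇛v Ms' → meta k Ms ⇛ meta k Ms'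
      pbeta : Q ⇛ Q' → N ⇛ N' → l ⇛l l' →
              app (lam A Q) (cons N l) ⇛ appN (sub (N' • ids) Q') l'

    data _⇛l_ : Lst → Lst → Set where
      pnil : nil ⇛l nil
      pcons : M ⇛ M' → l ⇛l l' → cons M l ⇛l cons M' l'
      pcat : l₁ ⇛l l₀ → l₂ ⇛l l₀' → cat l₁ l₂ ⇛l cat l₀ l₀'
      pesubL : N ⇛ N' → A ⇛ A' → l ⇛l l' → esubL N A l ⇛l esubL N' A' l'
      pmetaL : ∀ {k} {Ms Ms' : Vec Term (arL k)} → Ms ⇛v Ms' → metaL k Ms ⇛l metaL k Ms'

    data _⇛v_ : ∀ {n} → Vec Term n → Vec Term n → Set where
      p[] : [] ⇛v []
      _p∷_ : ∀ {n} {Ms Ms' : Vec Term n} → M ⇛ M' → Ms ⇛v Ms' → (M ∷ Ms) ⇛v (M' ∷ Ms')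

  mutual
    ⇛-refl : ∀ M → M ⇛ M
    ⇛-refl (pi A Q) = ppi (⇛-refl A) (⇛-refl Q)
    ⇛-refl (lam A Q) = plam (⇛-refl A) (⇛-refl Q)
    ⇛-refl (sort s) = psort
    ⇛-refl (vapp k l) = pvapp (⇛l-refl l)
    ⇛-refl (app M l) = papp (⇛-refl M) (⇛l-refl l)
    ⇛-refl (esub N A M) = pesub (⇛-refl N) (⇛-refl A) (⇛-refl M)
    ⇛-refl (meta k Ms) = pmeta (⇛v-refl Ms)

    ⇛l-refl : ∀ l → l ⇛l l
    ⇛l-refl nil = pnil
    ⇛l-refl (cons M l) = pcons (⇛-refl M) (⇛l-refl l)
    ⇛l-refl (cat l₁ l₂) = pcat (⇛l-refl l₁) (⇛l-refl l₂)
    ⇛l-refl (esubL N A l) = pesubL (⇛-refl N) (⇛-refl A) (⇛l-refl l)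
    ⇛l-refl (metaL k Ms) = pmetaL (⇛v-refl Ms)

    ⇛v-refl : ∀ {n} (Ms : Vec Term n) → Ms ⇛v Ms
    ⇛v-refl [] = p[]
    ⇛v-refl (M ∷ Ms) = ⇛-refl M p∷ ⇛v-refl Ms

  cat?-⇛ : ∀ {c c'} → c ⇛l c' → l ⇛l l' → cat? c l ⇛l cat? c' l'
  cat?-⇛ hc pnil = hc
  cat?-⇛ hc (pcons a h) = pcat hc (pcons a h)
  cat?-⇛ hc (pcat h₁ h₂) = pcat hc (pcat h₁ h₂)
  cat?-⇛ hc (pesubL a b h) = pcat hc (pesubL a b h)
  cat?-⇛ hc (pmetaL v) = pcat hc (pmetaL v)

  catN-⇛ : l₁ ⇛l l₀ → l₂ ⇛l l₀' → catN l₁ l₂ ⇛l catN l₀ l₀'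
  catN-⇛ pnil h = h
  catN-⇛ (pcons a h₁) h = pcons a (catN-⇛ h₁ h)
  catN-⇛ (pcat h₁ h₂) h = pcat h₁ (catN-⇛ h₂ h)
  catN-⇛ (pesubL a b h₁) h = cat?-⇛ (pesubL a b h₁) h
  catN-⇛ (pmetaL v) h = cat?-⇛ (pmetaL v) h

  app?-⇛ : M ⇛ M' → l ⇛l l' → app? M l ⇛ app? M' l'
  app?-⇛ d pnil = d
  app?-⇛ d (pcons a h) = papp d (pcons a h)
  app?-⇛ d (pcat h₁ h₂) = papp d (pcat h₁ h₂)
  app?-⇛ d (pesubL a b h) = papp d (pesubL a b h)
  app?-⇛ d (pmetaL v) = papp d (pmetaL v)

  appN-⇛ : M ⇛ M' → l ⇛l l' → appN M l ⇛ appN M' l'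
  appN-⇛ d@(ppi _ _) h = app?-⇛ d h
  appN-⇛ d@(plam _ _) h = app?-⇛ d h
  appN-⇛ d@psort h = app?-⇛ d h
  appN-⇛ (pvapp h₀) h = pvapp (catN-⇛ h₀ h)
  appN-⇛ (papp d h₀) h = papp d (catN-⇛ h₀ h)
  appN-⇛ d@(pesub _ _ _) h = app?-⇛ d h
  appN-⇛ d@(pmeta _) h = app?-⇛ d h
  appN-⇛ {l' = l'} (pbeta {Q' = Q'} {N' = N'} {l' = l₀'} dQ dN h₀) h =
    subst (_ ⇛_) (sym (appN-assoc (sub (N' • ids) Q') l₀' l')) (pbeta dQ dN (catN-⇛ h₀ h))

  ren-beta-eq : ∀ ρ N' Q' l' → appN (sub (renT ρ N' • ids) (renT (ext ρ) Q')) (renL ρ l')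
                              ≡ renT ρ (appN (sub (N' • ids) Q') l')
  ren-beta-eq ρ N' Q' l' =
    cong (λ z → appN z (renL ρ l')) (sub-ren _ _ Q' ▸ sub-cong pt Q' ▸ sym (ren-sub ρ _ Q'))
    ▸ sym (ren-appN ρ (sub (N' • ids) Q') l')
    where
    pt : (λ i → (renT ρ N' • ids) (ext ρ i)) ≗ (λ i → renT ρ ((N' • ids) i))
    pt zero    = refl
    pt (suc i) = refl

  mutual
    ren-⇛ : ∀ ρ → M ⇛ M' → renT ρ M ⇛ renT ρ M'
    ren-⇛ ρ (ppi a b) = ppi (ren-⇛ ρ a) (ren-⇛ (ext ρ) b)
    ren-⇛ ρ (plam a b) = plam (ren-⇛ ρ a) (ren-⇛ (ext ρ) b)
    ren-⇛ ρ psort = psort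
    ren-⇛ ρ (pvapp h) = pvapp (renL-⇛ ρ h)
    ren-⇛ ρ (papp d h) = papp (ren-⇛ ρ d) (renL-⇛ ρ h)
    ren-⇛ ρ (pesub a b c) = pesub (ren-⇛ ρ a) (ren-⇛ ρ b) (ren-⇛ (ext ρ) c)
    ren-⇛ ρ (pmeta v) = pmeta (renV-⇛ ρ v)
    ren-⇛ ρ (pbeta {Q' = Q'} {N' = N'} {l' = l'} dQ dN h) =
      subst (_ ⇛_) (ren-beta-eq ρ N' Q' l') (pbeta (ren-⇛ (ext ρ) dQ) (ren-⇛ ρ dN) (renL-⇛ ρ h))

    renL-⇛ : ∀ ρ → l ⇛l l' → renL ρ l ⇛l renL ρ l'
    renL-⇛ ρ pnil = pnil
    renL-⇛ ρ (pcons a h) = pcons (ren-⇛ ρ a) (renL-⇛ ρ h)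
    renL-⇛ ρ (pcat h₁ h₂) = pcat (renL-⇛ ρ h₁) (renL-⇛ ρ h₂)
    renL-⇛ ρ (pesubL a b h) = pesubL (ren-⇛ ρ a) (ren-⇛ ρ b) (renL-⇛ (ext ρ) h)
    renL-⇛ ρ (pmetaL v) = pmetaL (renV-⇛ ρ v)

    renV-⇛ : ∀ ρ {n} {Ms Ms' : Vec Term n} → Ms ⇛v Ms' → renV ρ Ms ⇛v renV ρ Ms'
    renV-⇛ ρ p[] = p[]
    renV-⇛ ρ (a p∷ v) = ren-⇛ ρ a p∷ renV-⇛ ρ v

  appN-head : Head M → NonNil l → appN M l ≡ app M l
  appN-head hpi nn = app?-nonNil _ nn
  appN-head hlam nn = app?-nonNil _ nn
  appN-head hsort nn = app?-nonNil _ nn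
  appN-head hmeta nn = app?-nonNil _ nn

  mutual
    nf-fix : Nf M → sub ids M ≡ M
    nf-fix (npi {Q = Q} a b) = cong₂ pi (nf-fix a) (sub-cong exts-ids Q ▸ nf-fix b)
    nf-fix (nlam {Q = Q} a b) = cong₂ lam (nf-fix a) (sub-cong exts-ids Q ▸ nf-fix b)
    nf-fix nsort = refl
    nf-fix (nvapp {k = k} h) = cong (vapp k) (nfL-fix h)
    nf-fix (napp hd nn a h) = cong₂ appN (nf-fix a) (nfL-fix h) ▸ appN-head hd nn
    nf-fix (nmeta {k = k} v) = cong (meta k) (nfV-fix v)

    nfL-fix : NfL l → subL ids l ≡ l
    nfL-fix nnil = refl
    nfL-fix (ncons a h) = cong₂ cons (nf-fix a) (nfL-fix h)
    nfL-fix (ncat {k = k} v nn h) =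
      cong₂ (λ u w → cat? (metaL k u) w) (nfV-fix v) (nfL-fix h) ▸ cat?-nonNil _ nn
    nfL-fix (nmetaL {k = k} v) = cong (metaL k) (nfV-fix v)

    nfV-fix : ∀ {n} {Ms : Vec Term n} → NfV Ms → subV ids Ms ≡ Ms
    nfV-fix n[] = refl
    nfV-fix (a n∷ v) = cong₂ _∷_ (nf-fix a) (nfV-fix v)

  _⇛s_ : (ℕ → Term) → (ℕ → Term) → Set
  σ ⇛s τ = ∀ i → σ i ⇛ τ i

  exts-⇛ : ∀ {σ τ} → σ ⇛s τ → exts σ ⇛s exts τ
  exts-⇛ h zero = ⇛-refl _
  exts-⇛ h (suc i) = ren-⇛ suc (h i)

  •-⇛ : ∀ {σ τ} → P ⇛ Q → σ ⇛s τ → (P • σ) ⇛s (Q • τ)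
  •-⇛ d h zero = d
  •-⇛ d h (suc i) = h i

  beta-sub-eq : ∀ σ' N' Q' → NfS σ' →
                sub (sub σ' N' • ids) (sub (exts σ') Q') ≡ sub σ' (sub (N' • ids) Q')
  beta-sub-eq σ' N' Q' hn = sub-sub _ _ Q' ▸ sub-cong pt Q' ▸ sym (sub-sub σ' _ Q')
    where
    pt : (λ i → sub (sub σ' N' • ids) (exts σ' i)) ≗ (λ i → sub σ' ((N' • ids) i))
    pt zero    = appN-nilʳ (sub σ' N')
    pt (suc i) = sub-ren _ suc (σ' i) ▸ nf-fix (hn i) ▸ sym (appN-nilʳ (σ' i))

  mutual
    sub-⇛ : ∀ {σ σ'} → σ ⇛s σ' → NfS σ' → M ⇛ M' → sub σ M ⇛ sub σ' M'
    sub-⇛ h hn (ppi a b) = ppi (sub-⇛ h hn a) (sub-⇛ (exts-⇛ h) (Nf-exts hn) b)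
    sub-⇛ h hn (plam a b) = plam (sub-⇛ h hn a) (sub-⇛ (exts-⇛ h) (Nf-exts hn) b)
    sub-⇛ h hn psort = psort
    sub-⇛ h hn (pvapp {k = k} hl) = appN-⇛ (h k) (subL-⇛ h hn hl)
    sub-⇛ h hn (papp d hl) = appN-⇛ (sub-⇛ h hn d) (subL-⇛ h hn hl)
    sub-⇛ h hn (pesub {N' = N'} a b c) = sub-⇛ (•-⇛ (sub-⇛ h hn a) h) (Nf-• (Nf-sub hn N') hn) c
    sub-⇛ h hn (pmeta v) = pmeta (subV-⇛ h hn v)
    sub-⇛ {σ' = σ'} h hn (pbeta {Q' = Q'} {N' = N'} {l' = l'} dQ dN hl) =
      subst (_ ⇛_)
            (cong (λ z → appN z (subL σ' l')) (beta-sub-eq σ' N' Q' hn)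
             ▸ sym (sub-appN σ' (sub (N' • ids) Q') l'))
            (pbeta (sub-⇛ (exts-⇛ h) (Nf-exts hn) dQ) (sub-⇛ h hn dN) (subL-⇛ h hn hl))

    subL-⇛ : ∀ {σ σ'} → σ ⇛s σ' → NfS σ' → l ⇛l l' → subL σ l ⇛l subL σ' l'
    subL-⇛ h hn pnil = pnil
    subL-⇛ h hn (pcons a hl) = pcons (sub-⇛ h hn a) (subL-⇛ h hn hl)
    subL-⇛ h hn (pcat h₁ h₂) = catN-⇛ (subL-⇛ h hn h₁) (subL-⇛ h hn h₂)
    subL-⇛ h hn (pesubL {N' = N'} a b c) = subL-⇛ (•-⇛ (sub-⇛ h hn a) h) (Nf-• (Nf-sub hn N') hn) c
    subL-⇛ h hn (pmetaL v) = pmetaL (subV-⇛ h hn v)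

    subV-⇛ : ∀ {σ σ'} → σ ⇛s σ' → NfS σ' → ∀ {n} {Ms Ms' : Vec Term n} → Ms ⇛v Ms' →
             subV σ Ms ⇛v subV σ' Ms'
    subV-⇛ h hn p[] = p[]
    subV-⇛ h hn (a p∷ v) = sub-⇛ h hn a p∷ subV-⇛ h hn v

  Head-pres : Head M → M ⇛ M' → Head M'
  Head-pres hpi (ppi _ _) = hpi
  Head-pres hlam (plam _ _) = hlam
  Head-pres hsort psort = hsort
  Head-pres hmeta (pmeta _) = hmeta

  NonNil-pres : NonNil l → l ⇛l l' → NonNil l'
  NonNil-pres nncons (pcons _ _) = nncons
  NonNil-pres nncat (pcat _ _) = nncat
  NonNil-pres nnesubL (pesubL _ _ _) = nnesubL
  NonNil-pres nnmetaL (pmetaL _) = nnmetaL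

  mutual
    Nf-pres : Nf M → M ⇛ M' → Nf M'
    Nf-pres (npi a b) (ppi d e) = npi (Nf-pres a d) (Nf-pres b e)
    Nf-pres (nlam a b) (plam d e) = nlam (Nf-pres a d) (Nf-pres b e)
    Nf-pres nsort psort = nsort
    Nf-pres (nvapp h) (pvapp e) = nvapp (NfL-pres h e)
    Nf-pres (napp hd nn a h) (papp d e) =
      napp (Head-pres hd d) (NonNil-pres nn e) (Nf-pres a d) (NfL-pres h e)
    Nf-pres (napp hd nn (nlam a b) (ncons c h)) (pbeta {Q' = Q'} dQ dN e) =
      Nf-appN (Nf-sub (Nf-• (Nf-pres c dN) Nf-ids) Q') (NfL-pres h e)
    Nf-pres (nmeta v) (pmeta e) = nmeta (NfV-pres v e)

    NfL-pres : NfL l → l ⇛l l' → NfL l'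
    NfL-pres nnil pnil = nnil
    NfL-pres (ncons a h) (pcons d e) = ncons (Nf-pres a d) (NfL-pres h e)
    NfL-pres (ncat v nn h) (pcat (pmetaL w) e) =
      ncat (NfV-pres v w) (NonNil-pres nn e) (NfL-pres h e)
    NfL-pres (nmetaL v) (pmetaL w) = nmetaL (NfV-pres v w)

    NfV-pres : ∀ {n} {Ms Ms' : Vec Term n} → NfV Ms → Ms ⇛v Ms' → NfV Ms'
    NfV-pres n[] p[] = n[]
    NfV-pres (a n∷ v) (d p∷ w) = Nf-pres a d n∷ NfV-pres v w

  mutual
    cd : Term → Term
    cd (pi A Q) = pi (cd A) (cd Q)
    cd (lam A Q) = lam (cd A) (cd Q)
    cd (sort s) = sort s
    cd (vapp k l) = vapp k (cdL l)
    cd (app M l) = cdApp M l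
    cd (esub N A M) = esub (cd N) (cd A) (cd M)
    cd (meta k Ms) = meta k (cdV Ms)

    cdApp : Term → Lst → Term
    cdApp (lam A Q) (cons N l) = appN (sub (cd N • ids) (cd Q)) (cdL l)
    cdApp M l = app (cd M) (cdL l)

    cdL : Lst → Lst
    cdL nil = nil
    cdL (cons M l) = cons (cd M) (cdL l)
    cdL (cat l₁ l₂) = cat (cdL l₁) (cdL l₂)
    cdL (esubL N A l) = esubL (cd N) (cd A) (cdL l)
    cdL (metaL k Ms) = metaL k (cdV Ms)

    cdV : ∀ {n} → Vec Term n → Vec Term n
    cdV [] = []
    cdV (M ∷ Ms) = cd M ∷ cdV Ms

  mutual
    develop : ∀ M → M ⇛ cd M
    develop (pi A Q) = ppi (develop A) (develop Q)
    develop (lam A Q) = plam (develop A) (develop Q)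
    develop (sort s) = psort
    develop (vapp k l) = pvapp (developL l)
    develop (app M l) = develop-app M l
    develop (esub N A M) = pesub (develop N) (develop A) (develop M)
    develop (meta k Ms) = pmeta (developV Ms)

    develop-app : ∀ M l → app M l ⇛ cdApp M l
    develop-app (lam A Q) (cons N l) = pbeta (develop Q) (develop N) (developL l)
    develop-app (lam A Q) nil = papp (develop _) (developL _)
    develop-app (lam A Q) (cat l₁ l₂) = papp (develop _) (developL _)
    develop-app (lam A Q) (esubL N B₀ l) = papp (develop _) (developL _)
    develop-app (lam A Q) (metaL k Ms) = papp (develop _) (developL _)
    develop-app (pi A Q) l = papp (develop _) (developL _)
    develop-app (sort s) l = papp (develop _) (developL _)
    develop-app (vapp k l₀) l = papp (develop _) (developL _)
    develop-app (app M l₀) l = papp (develop _) (developL _)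
    develop-app (esub N A M) l = papp (develop _) (developL _)
    develop-app (meta k Ms) l = papp (develop _) (developL _)

    developL : ∀ l → l ⇛l cdL l
    developL nil = pnil
    developL (cons M l) = pcons (develop M) (developL l)
    developL (cat l₁ l₂) = pcat (developL l₁) (developL l₂)
    developL (esubL N A l) = pesubL (develop N) (develop A) (developL l)
    developL (metaL k Ms) = pmetaL (developV Ms)

    developV : ∀ {n} (Ms : Vec Term n) → Ms ⇛v cdV Ms
    developV [] = p[]
    developV (M ∷ Ms) = develop M p∷ developV Ms

  mutual
    triangle : Nf M → M ⇛ M' → M' ⇛ cd M
    triangle (npi a b) (ppi d e) = ppi (triangle a d) (triangle b e)
    triangle (nlam a b) (plam d e) = plam (triangle a d) (triangle b e)
    triangle nsort psort = psort
    triangle (nvapp h) (pvapp e) = pvapp (triangleL h e)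
    triangle (napp hd nn a h) (papp d e) = triangle-app hd nn a h d e
    triangle (napp _ _ (nlam _ b) (ncons {M = N} c h)) (pbeta dQ dN e) =
      appN-⇛ (sub-⇛ (•-⇛ (triangle c dN) (λ i → ⇛-refl _)) (Nf-• (Nf-pres c (develop N)) Nf-ids)
                    (triangle b dQ))
             (triangleL h e)
    triangle (nmeta v) (pmeta w) = pmeta (triangleV v w)

    triangle-app : Head M → NonNil l → Nf M → NfL l → M ⇛ M' → l ⇛l l' → app M' l' ⇛ cdApp M l
    triangle-app hlam nncons (nlam a b) (ncons c h) (plam dA dQ) (pcons dN e) =
      pbeta (triangle b dQ) (triangle c dN) (triangleL h e)
    triangle-app hlam nncat a h d e = papp (triangle a d) (triangleL h e)
    triangle-app hlam nnesubL a h d e = papp (triangle a d) (triangleL h e)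
    triangle-app hlam nnmetaL a h d e = papp (triangle a d) (triangleL h e)
    triangle-app hpi nn a h d e = papp (triangle a d) (triangleL h e)
    triangle-app hsort nn a h d e = papp (triangle a d) (triangleL h e)
    triangle-app hmeta nn a h d e = papp (triangle a d) (triangleL h e)

    triangleL : NfL l → l ⇛l l' → l' ⇛l cdL l
    triangleL nnil pnil = pnil
    triangleL (ncons a h) (pcons d e) = pcons (triangle a d) (triangleL h e)
    triangleL (ncat v nn h) (pcat (pmetaL w) e) = pcat (pmetaL (triangleV v w)) (triangleL h e)
    triangleL (nmetaL v) (pmetaL w) = pmetaL (triangleV v w)

    triangleV : ∀ {n} {Ms Ms' : Vec Term n} → NfV Ms → Ms ⇛v Ms' → Ms' ⇛v cdV Ms
    triangleV n[] p[] = p[]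
    triangleV (a n∷ v) (d p∷ w) = triangle a d p∷ triangleV v w

  -- Simulation: a Bx'-step M → N becomes a ⇛-sequence sub σ M ⇛* sub σ N
  -- for every normal σ.  x'-steps vanish by (ii); a B-step becomes one
  -- parallel β-step.
  _⇛*_ : Term → Term → Set
  _⇛*_ = Star _⇛_
  _⇛l*_ : Lst → Lst → Set
  _⇛l*_ = Star _⇛l_
  _⇛v*_ : ∀ {n} → Vec Term n → Vec Term n → Set
  _⇛v*_ = Star _⇛v_

  gmap-Nf : {Y : Set} {T : Y → Y → Set} (f : Term → Y) →
            (∀ {u v} → Nf u → u ⇛ v → T (f u) (f v)) →
            ∀ {u v} → Nf u → u ⇛* v → Star T (f u) (f v)
  gmap-Nf f g nu ε        = ε
  gmap-Nf f g nu (d ◅ ds) = g nu d ◅ gmap-Nf f g (Nf-pres nu d) ds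

  sub-B-step : ∀ σ → NfS σ → ∀ A M N l →
               sub σ (app (lam A M) (cons N l)) ⇛ sub σ (app (esub N A M) l)
  sub-B-step σ hn A M N l =
    subst (sub σ (app (lam A M) (cons N l)) ⇛_) contractum
          (pbeta (⇛-refl _) (⇛-refl _) (⇛l-refl _))
    where
    lift-then-subst : (λ i → sub (sub σ N • ids) (exts σ i)) ≗ (sub σ N • σ)
    lift-then-subst zero    = appN-nilʳ _
    lift-then-subst (suc i) = sub-ren _ suc (σ i) ▸ nf-fix (hn i)
    contractum : appN (sub (sub σ N • ids) (sub (exts σ) M)) (subL σ l)
               ≡ appN (sub (sub σ N • σ) M) (subL σ l)
    contractum = cong (λ z → appN z (subL σ l)) (sub-sub _ _ M ▸ sub-cong lift-then-subst M)

  mutual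
    simulate : ∀ {M N} → M BX'.⟶t N → ∀ {σ} → NfS σ → sub σ M ⇛* sub σ N
    simulate (BX'.root (B {A} {M} {N} {l})) {σ} hn = sub-B-step σ hn A M N l ◅ ε
    simulate (BX'.root (x r)) {σ} hn = cast refl (sub-XT-invariant r σ) ε
    simulate (BX'.piˡ {B = Q} d) {σ} hn =
      gmap (λ u → pi u (sub (exts σ) Q)) (λ e → ppi e (⇛-refl _)) (simulate d hn)
    simulate (BX'.piʳ {A} d) {σ} hn =
      gmap (pi (sub σ A)) (ppi (⇛-refl _)) (simulate d (Nf-exts hn))
    simulate (BX'.lamˡ {M = Q} d) {σ} hn =
      gmap (λ u → lam u (sub (exts σ) Q)) (λ e → plam e (⇛-refl _)) (simulate d hn)
    simulate (BX'.lamʳ {A} d) {σ} hn =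
      gmap (lam (sub σ A)) (plam (⇛-refl _)) (simulate d (Nf-exts hn))
    simulate (BX'.vappʳ {x = k} d) {σ} hn =
      gmap (appN (σ k)) (appN-⇛ (⇛-refl (σ k))) (simulateL d hn)
    simulate (BX'.appˡ {l = l} d) {σ} hn =
      gmap (λ u → appN u (subL σ l)) (λ e → appN-⇛ e (⇛l-refl _)) (simulate d hn)
    simulate (BX'.appʳ {M} d) {σ} hn =
      gmap (appN (sub σ M)) (appN-⇛ (⇛-refl (sub σ M))) (simulateL d hn)
    simulate (BX'.esub₁ {N} {M = M} d) {σ} hn =
      gmap-Nf (λ u → sub (u • σ) M)
              (λ nu e → sub-⇛ (•-⇛ e (λ i → ⇛-refl _)) (Nf-• (Nf-pres nu e) hn) (⇛-refl M))
              (Nf-sub hn N) (simulate d hn)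
    simulate (BX'.esub₂ d) hn = ε
    simulate (BX'.esub₃ {N} d) {σ} hn = simulate d (Nf-• (Nf-sub hn N) hn)
    simulate (BX'.metaᶜ {α = k} d) hn = gmap (meta k) pmeta (simulateV d hn)

    simulateL : ∀ {l l'} → l BX'.⟶l l' → ∀ {σ} → NfS σ → subL σ l ⇛l* subL σ l'
    simulateL (BX'.root r) {σ} hn = cast refl (subL-XL-invariant r σ) ε
    simulateL (BX'.consˡ {l = l} d) {σ} hn =
      gmap (λ u → cons u (subL σ l)) (λ e → pcons e (⇛l-refl _)) (simulate d hn)
    simulateL (BX'.consʳ {M} d) {σ} hn =
      gmap (cons (sub σ M)) (pcons (⇛-refl _)) (simulateL d hn)
    simulateL (BX'.catˡ {l₂ = l₂} d) {σ} hn =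
      gmap (λ u → catN u (subL σ l₂)) (λ e → catN-⇛ e (⇛l-refl _)) (simulateL d hn)
    simulateL (BX'.catʳ {l₁} d) {σ} hn =
      gmap (catN (subL σ l₁)) (catN-⇛ (⇛l-refl (subL σ l₁))) (simulateL d hn)
    simulateL (BX'.esubL₁ {N} {l = l} d) {σ} hn =
      gmap-Nf (λ u → subL (u • σ) l)
              (λ nu e → subL-⇛ (•-⇛ e (λ i → ⇛-refl _)) (Nf-• (Nf-pres nu e) hn) (⇛l-refl l))
              (Nf-sub hn N) (simulate d hn)
    simulateL (BX'.esubL₂ d) hn = ε
    simulateL (BX'.esubL₃ {N} d) {σ} hn = simulateL d (Nf-• (Nf-sub hn N) hn)
    simulateL (BX'.metaLᶜ {β = k} d) hn = gmap (metaL k) pmetaL (simulateV d hn)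

    simulateV : ∀ {n} {Ms Ms' : Vec Term n} → Ms BX'.⟶v Ms' → ∀ {σ} → NfS σ →
                subV σ Ms ⇛v* subV σ Ms'
    simulateV (BX'.here {Ms = Ms} d) {σ} hn =
      gmap (λ u → u ∷ subV σ Ms) (λ e → e p∷ ⇛v-refl _) (simulate d hn)
    simulateV (BX'.there {M = M} d) {σ} hn =
      gmap (sub σ M ∷_) (⇛-refl _ p∷_) (simulateV d hn)

  _↠Bx'_ : Term → Term → Set
  _↠Bx'_ = Star BX'._⟶t_
  _↠Bx'ˡ_ : Lst → Lst → Set
  _↠Bx'ˡ_ = Star BX'._⟶l_
  _↠Bx'ᵛ_ : ∀ {n} → Vec Term n → Vec Term n → Set
  _↠Bx'ᵛ_ = Star BX'._⟶v_

  mutual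
    x'⊆Bx' : ∀ {M N} → M X'.⟶t N → M BX'.⟶t N
    x'⊆Bx' (X'.root r)  = BX'.root (x r)
    x'⊆Bx' (X'.piˡ d)   = BX'.piˡ (x'⊆Bx' d)
    x'⊆Bx' (X'.piʳ d)   = BX'.piʳ (x'⊆Bx' d)
    x'⊆Bx' (X'.lamˡ d)  = BX'.lamˡ (x'⊆Bx' d)
    x'⊆Bx' (X'.lamʳ d)  = BX'.lamʳ (x'⊆Bx' d)
    x'⊆Bx' (X'.vappʳ d) = BX'.vappʳ (x'⊆Bx'ˡ d)
    x'⊆Bx' (X'.appˡ d)  = BX'.appˡ (x'⊆Bx' d)
    x'⊆Bx' (X'.appʳ d)  = BX'.appʳ (x'⊆Bx'ˡ d)
    x'⊆Bx' (X'.esub₁ d) = BX'.esub₁ (x'⊆Bx' d)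
    x'⊆Bx' (X'.esub₂ d) = BX'.esub₂ (x'⊆Bx' d)
    x'⊆Bx' (X'.esub₃ d) = BX'.esub₃ (x'⊆Bx' d)
    x'⊆Bx' (X'.metaᶜ d) = BX'.metaᶜ (x'⊆Bx'ᵛ d)

    x'⊆Bx'ˡ : ∀ {l l'} → l X'.⟶l l' → l BX'.⟶l l'
    x'⊆Bx'ˡ (X'.root r)   = BX'.root r
    x'⊆Bx'ˡ (X'.consˡ d)  = BX'.consˡ (x'⊆Bx' d)
    x'⊆Bx'ˡ (X'.consʳ d)  = BX'.consʳ (x'⊆Bx'ˡ d)
    x'⊆Bx'ˡ (X'.catˡ d)   = BX'.catˡ (x'⊆Bx'ˡ d)
    x'⊆Bx'ˡ (X'.catʳ d)   = BX'.catʳ (x'⊆Bx'ˡ d)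
    x'⊆Bx'ˡ (X'.esubL₁ d) = BX'.esubL₁ (x'⊆Bx' d)
    x'⊆Bx'ˡ (X'.esubL₂ d) = BX'.esubL₂ (x'⊆Bx' d)
    x'⊆Bx'ˡ (X'.esubL₃ d) = BX'.esubL₃ (x'⊆Bx'ˡ d)
    x'⊆Bx'ˡ (X'.metaLᶜ d) = BX'.metaLᶜ (x'⊆Bx'ᵛ d)

    x'⊆Bx'ᵛ : ∀ {n} {Ms Ms' : Vec Term n} → Ms X'.⟶v Ms' → Ms BX'.⟶v Ms'
    x'⊆Bx'ᵛ (X'.here d)  = BX'.here (x'⊆Bx' d)
    x'⊆Bx'ᵛ (X'.there d) = BX'.there (x'⊆Bx'ᵛ d)

  x'↠⊆Bx'↠ : ∀ {M N} → M ↠x' N → M ↠Bx' N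
  x'↠⊆Bx'↠ = gmap (λ u → u) x'⊆Bx'

  x'↠⊆Bx'↠ˡ : ∀ {l l'} → l ↠x'ˡ l' → l ↠Bx'ˡ l'
  x'↠⊆Bx'↠ˡ = gmap (λ u → u) x'⊆Bx'ˡ

  -- A β-contraction with reduced components, realised by B followed by
  -- pushing the explicit substitution through the normal body.
  β-realised : Nf Q' → Q ↠Bx' Q' → N ↠Bx' N' → l ↠Bx'ˡ l' →
               app (lam A Q) (cons N l) ↠Bx' appN (sub (N' • ids) Q') l'
  β-realised {Q'} {Q} {N} {N'} {l} {l'} {A} nQ' dQ dN dl =
    BX'.root B
    ◅ gmap (λ u → app u l) BX'.appˡ (gmap (λ u → esub u A Q) BX'.esub₁ dN
                                    ◅◅ gmap (esub N' A) BX'.esub₃ dQ)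
    ◅◅ gmap (app _) BX'.appʳ dl
    ◅◅ x'↠⊆Bx'↠ (gmap (λ u → app u l') X'.appˡ (push-esub-nf nQ' N' A) ◅◅ app↠appN _ _)

  mutual
    realise : Nf M → M ⇛ M' → M ↠Bx' M'
    realise (npi a b) (ppi d e) =
      gmap (λ u → pi u _) BX'.piˡ (realise a d) ◅◅ gmap (pi _) BX'.piʳ (realise b e)
    realise (nlam a b) (plam d e) =
      gmap (λ u → lam u _) BX'.lamˡ (realise a d) ◅◅ gmap (lam _) BX'.lamʳ (realise b e)
    realise nsort psort = ε
    realise (nvapp h) (pvapp e) = gmap (vapp _) BX'.vappʳ (realiseL h e)
    realise (napp hd nn a h) (papp d e) =
      gmap (λ u → app u _) BX'.appˡ (realise a d) ◅◅ gmap (app _) BX'.appʳ (realiseL h e)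
    realise (napp _ _ (nlam _ nQ) (ncons nN nl)) (pbeta dQ dN e) =
      β-realised (Nf-pres nQ dQ) (realise nQ dQ) (realise nN dN) (realiseL nl e)
    realise (nmeta v) (pmeta w) = gmap (meta _) BX'.metaᶜ (realiseV v w)

    realiseL : NfL l → l ⇛l l' → l ↠Bx'ˡ l'
    realiseL nnil pnil = ε
    realiseL (ncons a h) (pcons d e) =
      gmap (λ u → cons u _) BX'.consˡ (realise a d) ◅◅ gmap (cons _) BX'.consʳ (realiseL h e)
    realiseL (ncat v nn h) (pcat (pmetaL w) e) =
      gmap (λ u → cat (metaL _ u) _) (λ d → BX'.catˡ (BX'.metaLᶜ d)) (realiseV v w)
      ◅◅ gmap (cat _) BX'.catʳ (realiseL h e)
    realiseL (nmetaL v) (pmetaL w) = gmap (metaL _) BX'.metaLᶜ (realiseV v w)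

    realiseV : ∀ {n} {Ms Ms' : Vec Term n} → NfV Ms → Ms ⇛v Ms' → Ms ↠Bx'ᵛ Ms'
    realiseV n[] p[] = ε
    realiseV (a n∷ v) (d p∷ w) =
      gmap (λ u → u ∷ _) BX'.here (realise a d) ◅◅ gmap (_ ∷_) BX'.there (realiseV v w)

  Bx'-confluent : Confluent _⟶Bx'_
  Bx'-confluent =
    interpretation BX'._⟶t_ _⇛_ Nf nf (λ M → x'↠⊆Bx'↠ (reach-nf M)) (Nf-sub Nf-ids)
                   (λ d → simulate d Nf-ids) realise Nf-pres
                   (Triangle.confluent-on _⇛_ Nf Nf-pres cd triangle)

  Bx'ˡ-confluent : Confluent _⟶Bx'ˡ_
  Bx'ˡ-confluent =
    interpretation BX'._⟶l_ _⇛l_ NfL nfL (λ l → x'↠⊆Bx'↠ˡ (reach-nfL l)) (NfL-sub Nf-ids)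
                   (λ d → simulateL d Nf-ids) realiseL NfL-pres
                   (Triangle.confluent-on _⇛l_ NfL NfL-pres cdL triangleL)

corollary2p9 : (S : Set) (arT arL : ℕ → ℕ) →
    let open PTSC S arT arL in
    (Confluent _⟶x'_ × Confluent _⟶x'ˡ_) × (Confluent _⟶Bx'_ × Confluent _⟶Bx'ˡ_)
corollary2p9 S arT arL = (x'-confluent , x'ˡ-confluent) , (Bx'-confluent , Bx'ˡ-confluent)
  where open PTSCConfluence S arT arL
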